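{- Let $G$ and $H$ be finite simple graphs with $\mathbf{X}_G=\mathbf{X}_H$. Then $$\sum_{v\in V(G)} d(v)^2=\sum_{v\in V(H)} d(v)^2 .$$ That is, the sum of the squared vertex degrees of a graph is determined by its chromatic symmetric function.
   Context: For a finite simple graph $G$, $d(v)$ denotes the degree of the vertex $v$. The chromatic symmetric function of $G$ is $\mathbf{X}_G=\sum_{\kappa}\prod_{v\in V(G)} x_{\kappa(v)}$, where $x_1,x_2,\dots$ are commuting indeterminates and the sum is over all proper colorings $\kappa:V(G)\to\{1,2,3,\dots\}$ (i.e. $\kappa(u)\neq\kappa(v)$ whenever $uv\in E(G)$). -}

module Defs where

open import Data.Bool using (Bool; true; false; _∧_; if_then_else_)
open import Data.Nat using (ℕ; zero; suc; _+_; _*_)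
open import Data.Fin using (Fin; zero; suc)
open import Data.Fin.Properties using () renaming (_≟_ to _≟F_)
open import Data.Nat.Properties using () renaming (_≟_ to _≟N_)
open import Data.List using (List; []; _∷_; map; concatMap; allFin; length; filterᵇ)
open import Data.Nat.ListAction using (sum)
open import Data.Bool.ListAction using (and)
open import Relation.Nullary using (does)
open import Relation.Binary.PropositionalEquality using (_≡_)

record Graph (n : ℕ) : Set where
  field
    adj   : Fin n → Fin n → Bool
    sym   : ∀ u v → adj u v ≡ adj v u
    irrefl : ∀ v → adj v v ≡ false
open Graph public

countFin : (n : ℕ) → (Fin n → Bool) → ℕ
countFin n p = length (filterᵇ p (allFin n))

degree : ∀ {n} → Graph n → Fin n → ℕ
degree {n} G v = countFin n (adj G v)

sumSqDeg : ∀ {n} → Graph n → ℕ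
sumSqDeg {n} G = sum (map (λ v → degree G v * degree G v) (allFin n))

consF : ∀ {n k} → Fin k → (Fin n → Fin k) → (Fin (suc n) → Fin k)
consF c f zero = c
consF c f (suc i) = f i

allFuns : (n k : ℕ) → List (Fin n → Fin k)
allFuns zero k = (λ ()) ∷ []
allFuns (suc n) k = concatMap (λ c → map (consF c) (allFuns n k)) (allFin k)

isProper : ∀ {n k} → Graph n → (Fin n → Fin k) → Bool
isProper {n} G κ =
  and (concatMap (λ u → map (λ w → if adj G u w then (if does (κ u ≟F κ w) then false else true) else true)
                            (allFin n)) (allFin n))

hasType : ∀ {n k} → (Fin n → Fin k) → (Fin k → ℕ) → Bool
hasType {n} {k} κ α =
  and (map (λ i → does (countFin n (λ v → does (κ v ≟F i)) ≟N α i)) (allFin k))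

-- Coefficient of the monomial x_1^{α_1} ⋯ x_k^{α_k} in X_G
-- (colours 1..k are represented by Fin k; all other exponents are 0):
-- the number of proper colourings κ with |κ⁻¹(i)| = α_i for all i.
-- (Such colourings necessarily take values among the first k colours.)
cgCoeff : ∀ {n} → Graph n → (k : ℕ) → (Fin k → ℕ) → ℕ
cgCoeff {n} G k α = length (filterᵇ (λ κ → isProper G κ ∧ hasType κ α) (allFuns n k))

-- X_G = X_H as formal power series: all monomial coefficients agree.
-- Every monomial has finite support, hence is of the form above for some k.
SameCSF : ∀ {n m} → Graph n → Graph m → Set
SameCSF G H = ∀ (k : ℕ) (α : Fin k → ℕ) → cgCoeff G k α ≡ cgCoeff H k α

-- Let a coincidence of a colouring κ : V → V be an ordered pair of distinct vertices of the same
-- colour.  Since ∑ (class size)² = |V| + #coincidences, X_G determines the number of proper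
-- colourings with exactly j coincidences, for every j.  Among all colourings with two coincidences,
-- those with the coinciding pair an edge number (2|E|)·c₂; with four coincidences the coinciding
-- pairs are disjoint, and inclusion–exclusion over the two pairs brings in the number of ordered
-- pairs of edges with a common vertex, hence ∑ d(v)², with a positive factor c₄.  The constants
-- c₂ and c₄ do not depend on the vertices involved, because permuting vertices permutes colourings.
-- X_G also determines |V|, and graphs on at most three vertices are checked by hand.

module Submission where

open import Defs renaming (sym to adj-sym)
open import Data.Bool using (Bool; true; false; _∧_; not; if_then_else_; T)
open import Data.Bool.ListAction using (and)
open import Data.Empty using (⊥-elim)
open import Data.Fin using (Fin; zero; suc; toℕ; fromℕ<)
open import Data.Fin.Patterns using (0F; 1F; 2F; 3F)
open import Data.Fin.Permutation using (Permutation′; _⟨$⟩ʳ_; _⟨$⟩ˡ_; inverseˡ; _∘ₚ_; transpose)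
import Data.Fin.Permutation as Permutation
open import Data.Fin.Properties using (_≟_; toℕ-fromℕ<; toℕ-injective; suc-injective) renaming (0≢1+n to zero≢suc)
open import Data.List using (List; []; _∷_; _++_; map; concatMap; tabulate; allFin; length; filterᵇ)
open import Data.Nat using (ℕ; zero; suc; _+_; _*_; _≤_; _≡ᵇ_; z≤n; s≤s; >-nonZero)
import Data.Nat.ListAction as ℕL
open import Data.Nat.Properties
  using ( +-*-semiring; *-1-commutativeMonoid; module ≤-Reasoning; ≡ᵇ⇒≡
        ; +-identityʳ; *-identityˡ; *-identityʳ; *-zeroʳ; +-assoc; *-assoc; *-comm; *-distribˡ-+; *-distribʳ-+
        ; ≤-refl; ≤-reflexive; ≤-trans; m≤m+n; m≤m*n; +-mono-≤; +-monoʳ-≤; *-mono-≤; *-monoˡ-≤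
        ; +-cancelˡ-≡; *-cancelˡ-≡; *-cancelʳ-≡; +-cancelˡ-≤; *-cancelˡ-≤
        ; m+n≡0⇒m≡0; m+n≡0⇒n≡0; m*n≡1⇒m≡1; m*n≡1⇒n≡1 )
  renaming (_≟_ to _≟ℕ_)
open import Data.Nat.Tactic.RingSolver using (solve-∀)
open import Data.Product using (∃; _×_; _,_)
open import Function using (_∘_; id; case_of_)
open import Function.Definitions using (Injective)
open import Relation.Binary.PropositionalEquality
open import Relation.Nullary using (Dec; does; yes; no)
open import Relation.Nullary.Decidable using (dec-true; dec-false)
open import Algebra.Properties.Semiring.Sum +-*-semiring
  using (sum; sum-syntax; sum-cong-≗; ∑-distrib-+; ∑-comm; *-distribˡ-sum; *-distribʳ-sum; ∑-permute)
open import Algebra.Properties.CommutativeMonoid.Sum *-1-commutativeMonoid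
  using () renaming (sum to product; sum-cong-≗ to product-cong-≗; ∑-permute to ∏-permute)

private
  variable
    n k : ℕ

⟦_⟧ : Bool → ℕ
⟦ true ⟧ = 1
⟦ false ⟧ = 0

⟦∧⟧ : ∀ a b → ⟦ a ∧ b ⟧ ≡ ⟦ a ⟧ * ⟦ b ⟧
⟦∧⟧ true b = sym (+-identityʳ ⟦ b ⟧)
⟦∧⟧ false b = refl

⟦⟧-idem : ∀ b → ⟦ b ⟧ * ⟦ b ⟧ ≡ ⟦ b ⟧
⟦⟧-idem true = refl
⟦⟧-idem false = refl

Bool-ext : ∀ {a b : Bool} → (a ≡ true → b ≡ true) → (b ≡ true → a ≡ true) → a ≡ b
Bool-ext {true} {true} _ _ = refl
Bool-ext {true} {false} f _ = sym (f refl)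
Bool-ext {false} {true} _ g = g refl
Bool-ext {false} {false} _ _ = refl

∧-trueʳ : ∀ a {b} → a ∧ b ≡ true → b ≡ true
∧-trueʳ true b≡true = b≡true

does-true⁻ : {A : Set} (a? : Dec A) → does a? ≡ true → A
does-true⁻ (yes a) _ = a

δ : Fin n → Fin n → ℕ
δ i j = ⟦ does (i ≟ j) ⟧

δ-refl : (i : Fin n) → δ i i ≡ 1
δ-refl i = cong ⟦_⟧ (dec-true (i ≟ i) refl)

δ-≢ : {i j : Fin n} → i ≢ j → δ i j ≡ 0
δ-≢ {i = i} {j} i≢j = cong ⟦_⟧ (dec-false (i ≟ j) i≢j)

δ≡1⇒≡ : {i j : Fin n} → δ i j ≡ 1 → i ≡ j
δ≡1⇒≡ {i = i} {j} δ≡1 with i ≟ j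
... | yes i≡j = i≡j

δ-sym : (i j : Fin n) → δ i j ≡ δ j i
δ-sym i j with i ≟ j
... | yes refl = sym (δ-refl i)
... | no i≢j = sym (δ-≢ (i≢j ∘ sym))

δ-≤1 : (i j : Fin n) → δ i j ≤ 1
δ-≤1 i j with does (i ≟ j)
... | true = ≤-refl
... | false = z≤n

∑-zero : (f : Fin n → ℕ) → (∀ i → f i ≡ 0) → ∑[ i < n ] f i ≡ 0
∑-zero {zero} f f≡0 = refl
∑-zero {suc n} f f≡0 = cong₂ _+_ (f≡0 zero) (∑-zero (f ∘ suc) (f≡0 ∘ suc))

∑-zeros : ∀ r → ∑[ i < r ] 0 ≡ 0
∑-zeros r = ∑-zero {r} _ (λ _ → refl)

∑-zero⁻ : (f : Fin n → ℕ) → ∑[ i < n ] f i ≡ 0 → ∀ i → f i ≡ 0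
∑-zero⁻ f ∑≡0 zero = m+n≡0⇒m≡0 (f zero) ∑≡0
∑-zero⁻ f ∑≡0 (suc i) = ∑-zero⁻ (f ∘ suc) (m+n≡0⇒n≡0 (f zero) ∑≡0) i

∑-one : ∀ n → ∑[ i < n ] 1 ≡ n
∑-one zero = refl
∑-one (suc n) = cong suc (∑-one n)

∑-mono-≤ : {f g : Fin n → ℕ} → (∀ i → f i ≤ g i) → ∑[ i < n ] f i ≤ ∑[ i < n ] g i
∑-mono-≤ {zero} _ = z≤n
∑-mono-≤ {suc n} f≤g = +-mono-≤ (f≤g zero) (∑-mono-≤ (f≤g ∘ suc))

∑-δ : (t : Fin n) (f : Fin n → ℕ) → ∑[ i < n ] (δ t i * f i) ≡ f t
∑-δ {suc n} zero f =
  trans (cong₂ _+_ (+-identityʳ (f zero)) (∑-zero {n} _ (λ _ → refl))) (+-identityʳ (f zero))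
∑-δ {suc n} (suc t) f = ∑-δ t (f ∘ suc)

∑-δ-one : (t : Fin n) → ∑[ i < n ] δ t i ≡ 1
∑-δ-one t = trans (sum-cong-≗ (λ i → sym (*-identityʳ (δ t i)))) (∑-δ t (λ _ → 1))

∑-δˡ : (t : Fin n) (f : Fin n → ℕ) → ∑[ i < n ] (δ i t * f i) ≡ f t
∑-δˡ t f = trans (sum-cong-≗ (λ i → cong (_* f i) (δ-sym i t))) (∑-δ t f)

∑-≥-three : (f : Fin n → ℕ) {p q s : Fin n} → p ≢ q → p ≢ s → q ≢ s → f p + f q + f s ≤ ∑[ i < n ] f i
∑-≥-three {n} f {p} {q} {s} p≢q p≢s q≢s = begin
  f p + f q + f s
    ≡⟨ cong₂ _+_ (cong₂ _+_ (∑-δ p f) (∑-δ q f)) (∑-δ s f) ⟨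
  ∑[ i < n ] (δ p i * f i) + ∑[ i < n ] (δ q i * f i) + ∑[ i < n ] (δ s i * f i)
    ≡⟨ trans (∑-distrib-+ {n} _ (λ i → δ s i * f i)) (cong (_+ _) (∑-distrib-+ {n} _ _)) ⟨
  ∑[ i < n ] (δ p i * f i + δ q i * f i + δ s i * f i)
    ≤⟨ ∑-mono-≤ pointwise ⟩
  ∑[ i < n ] f i ∎
  where
  open ≤-Reasoning
  at-most-one : ∀ i → δ p i + δ q i + δ s i ≤ 1
  at-most-one i with p ≟ i
  ... | yes refl rewrite δ-≢ (p≢q ∘ sym) | δ-≢ (p≢s ∘ sym) = ≤-refl
  ... | no _ with q ≟ i
  ...   | yes refl rewrite δ-≢ (q≢s ∘ sym) = ≤-refl
  ...   | no _ = δ-≤1 s i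
  pointwise : ∀ i → δ p i * f i + δ q i * f i + δ s i * f i ≤ f i
  pointwise i = begin
    δ p i * f i + δ q i * f i + δ s i * f i ≡⟨ cong (_+ δ s i * f i) (*-distribʳ-+ (f i) (δ p i) (δ q i)) ⟨
    (δ p i + δ q i) * f i + δ s i * f i     ≡⟨ *-distribʳ-+ (f i) (δ p i + δ q i) (δ s i) ⟨
    (δ p i + δ q i + δ s i) * f i           ≤⟨ *-monoˡ-≤ (f i) (at-most-one i) ⟩
    1 * f i                                 ≡⟨ *-identityˡ (f i) ⟩
    f i                                     ∎

∑∑-even : ∀ n (f : Fin n → Fin n → ℕ) → (∀ u v → f u v ≡ f v u) → (∀ u → f u u ≡ 0) →
  ∃ λ h → ∑[ u < n ] ∑[ v < n ] f u v ≡ 2 * h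
∑∑-even zero f _ _ = 0 , refl
∑∑-even (suc n) f f-sym f-diag with ∑∑-even n (λ u v → f (suc u) (suc v)) (λ u v → f-sym _ _) (f-diag ∘ suc)
... | h , inner≡ = row + h , (begin
  f zero zero + row + ∑[ u < n ] (f (suc u) zero + ∑[ v < n ] f (suc u) (suc v))
    ≡⟨ cong₂ _+_ (cong (_+ row) (f-diag zero)) (∑-distrib-+ {n} _ _) ⟩
  row + (∑[ u < n ] f (suc u) zero + ∑[ u < n ] ∑[ v < n ] f (suc u) (suc v))
    ≡⟨ cong (row +_) (cong₂ _+_ (sum-cong-≗ {n} (λ u → f-sym (suc u) zero)) inner≡) ⟩
  row + (row + 2 * h)
    ≡⟨ regroup row h ⟩
  2 * (row + h) ∎)
  where
  open ≡-Reasoning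
  row : ℕ
  row = ∑[ v < n ] f zero (suc v)
  regroup : ∀ r h → r + (r + 2 * h) ≡ 2 * (r + h)
  regroup = solve-∀

module _ {A : Set} where

  length-filterᵇ-++ : (p : A → Bool) (xs ys : List A) →
    length (filterᵇ p (xs ++ ys)) ≡ length (filterᵇ p xs) + length (filterᵇ p ys)
  length-filterᵇ-++ p [] ys = refl
  length-filterᵇ-++ p (x ∷ xs) ys with p x
  ... | true = cong suc (length-filterᵇ-++ p xs ys)
  ... | false = length-filterᵇ-++ p xs ys

  length-filterᵇ-[_] : (p : A → Bool) (x : A) → length (filterᵇ p (x ∷ [])) ≡ ⟦ p x ⟧
  length-filterᵇ-[ p ] x with p x
  ... | true = refl
  ... | false = refl

  length-filterᵇ-tabulate : (p : A → Bool) (f : Fin n → A) →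
    length (filterᵇ p (tabulate f)) ≡ ∑[ i < n ] ⟦ p (f i) ⟧
  length-filterᵇ-tabulate {zero} p f = refl
  length-filterᵇ-tabulate {suc n} p f with p (f zero)
  ... | true = cong suc (length-filterᵇ-tabulate p (f ∘ suc))
  ... | false = length-filterᵇ-tabulate p (f ∘ suc)

  length-filterᵇ-concatMap-tabulate : {B : Set} (p : A → Bool) (g : B → List A) (f : Fin n → B) →
    length (filterᵇ p (concatMap g (tabulate f))) ≡ ∑[ i < n ] length (filterᵇ p (g (f i)))
  length-filterᵇ-concatMap-tabulate {zero} p g f = refl
  length-filterᵇ-concatMap-tabulate {suc n} p g f =
    trans (length-filterᵇ-++ p (g (f zero)) _)
          (cong (_ +_) (length-filterᵇ-concatMap-tabulate p g (f ∘ suc)))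

  length-filterᵇ-map : {B : Set} (p : A → Bool) (f : B → A) (xs : List B) →
    length (filterᵇ p (map f xs)) ≡ length (filterᵇ (p ∘ f) xs)
  length-filterᵇ-map p f [] = refl
  length-filterᵇ-map p f (x ∷ xs) with p (f x)
  ... | true = cong suc (length-filterᵇ-map p f xs)
  ... | false = length-filterᵇ-map p f xs

  length-filterᵇ≢0 : (p : A → Bool) (xs : List A) → length (filterᵇ p xs) ≢ 0 → ∃ λ x → p x ≡ true
  length-filterᵇ≢0 p [] ≢0 = ⊥-elim (≢0 refl)
  length-filterᵇ≢0 p (x ∷ xs) ≢0 with p x in px
  ... | true = x , px
  ... | false = length-filterᵇ≢0 p xs ≢0

  and-tabulate⁺ : (p : A → Bool) (f : Fin n → A) → (∀ i → p (f i) ≡ true) → and (map p (tabulate f)) ≡ true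
  and-tabulate⁺ {zero} p f all = refl
  and-tabulate⁺ {suc n} p f all rewrite all zero = and-tabulate⁺ p (f ∘ suc) (all ∘ suc)

  and-tabulate⁻ : (p : A → Bool) (f : Fin n → A) → and (map p (tabulate f)) ≡ true → ∀ i → p (f i) ≡ true
  and-tabulate⁻ {suc n} p f and≡ i with p (f zero) in p₀
  and-tabulate⁻ {suc n} p f and≡ zero | true = p₀
  and-tabulate⁻ {suc n} p f and≡ (suc i) | true = and-tabulate⁻ p (f ∘ suc) and≡ i

and-++ : (xs ys : List Bool) → and (xs ++ ys) ≡ and xs ∧ and ys
and-++ [] ys = refl
and-++ (true ∷ xs) ys = and-++ xs ys
and-++ (false ∷ xs) ys = refl

and-concatMap : {A : Set} (g : A → List Bool) (xs : List A) → and (concatMap g xs) ≡ and (map (and ∘ g) xs)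
and-concatMap g [] = refl
and-concatMap g (x ∷ xs) = trans (and-++ (g x) _) (cong (and (g x) ∧_) (and-concatMap g xs))

countFin-∑ : (p : Fin n → Bool) → countFin n p ≡ ∑[ i < n ] ⟦ p i ⟧
countFin-∑ p = length-filterᵇ-tabulate p id

sum-map-allFin : (f : Fin n → ℕ) → ℕL.sum (map f (allFin n)) ≡ ∑[ i < n ] f i
sum-map-allFin {n} f = go n id
  where
  go : ∀ m (g : Fin m → Fin n) → ℕL.sum (map f (tabulate g)) ≡ ∑[ i < m ] f (g i)
  go zero g = refl
  go (suc m) g = cong (f (g zero) +_) (go m (g ∘ suc))

-- Sums over all maps Fin n → Fin k

consF-cong : (c : Fin k) {κ κ′ : Fin n → Fin k} → κ ≗ κ′ → consF c κ ≗ consF c κ′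
consF-cong c κ≗κ′ zero = refl
consF-cong c κ≗κ′ (suc i) = κ≗κ′ i

consF-η : (t : Fin (suc n) → Fin k) → consF (t zero) (t ∘ suc) ≗ t
consF-η t zero = refl
consF-η t (suc i) = refl

Extensional : ((Fin n → Fin k) → ℕ) → Set
Extensional F = ∀ {κ κ′} → κ ≗ κ′ → F κ ≡ F κ′

Δ : (Fin n → Fin k) → (Fin n → Fin k) → ℕ
Δ κ κ′ = product (λ i → δ (κ i) (κ′ i))

Δ-≤1 : (κ κ′ : Fin n → Fin k) → Δ κ κ′ ≤ 1
Δ-≤1 {zero} κ κ′ = ≤-refl
Δ-≤1 {suc n} κ κ′ = *-mono-≤ (δ-≤1 (κ zero) (κ′ zero)) (Δ-≤1 (κ ∘ suc) (κ′ ∘ suc))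

Δ-≗ : {κ κ′ : Fin n → Fin k} → κ ≗ κ′ → Δ κ κ′ ≡ 1
Δ-≗ {zero} _ = refl
Δ-≗ {suc n} {κ = κ} κ≗κ′ rewrite sym (κ≗κ′ zero) | δ-refl (κ zero) =
  trans (+-identityʳ _) (Δ-≗ (κ≗κ′ ∘ suc))

Δ≡1⇒≗ : (κ κ′ : Fin n → Fin k) → Δ κ κ′ ≡ 1 → κ ≗ κ′
Δ≡1⇒≗ κ κ′ Δ≡1 zero = δ≡1⇒≡ (m*n≡1⇒m≡1 (δ (κ zero) (κ′ zero)) _ Δ≡1)
Δ≡1⇒≗ κ κ′ Δ≡1 (suc i) = Δ≡1⇒≗ (κ ∘ suc) (κ′ ∘ suc) (m*n≡1⇒n≡1 (δ (κ zero) (κ′ zero)) _ Δ≡1) i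

Δ-indicator : (b : (Fin n → Fin k) → Bool) (t : Fin n → Fin k) →
  (∀ κ → b κ ≡ true → κ ≗ t) → (∀ κ → κ ≗ t → b κ ≡ true) → ∀ κ → ⟦ b κ ⟧ ≡ Δ κ t
Δ-indicator b t b⇒≗ ≗⇒b κ with b κ in bκ
... | true = sym (Δ-≗ (b⇒≗ κ bκ))
... | false with Δ κ t in Δκ | Δ-≤1 κ t
...   | 0 | _ = refl
...   | 1 | _ = case trans (sym bκ) (≗⇒b κ (Δ≡1⇒≗ κ t Δκ)) of λ ()
...   | suc (suc _) | s≤s ()

Δ-sym : (κ κ′ : Fin n → Fin k) → Δ κ κ′ ≡ Δ κ′ κ
Δ-sym κ κ′ = product-cong-≗ (λ i → δ-sym (κ i) (κ′ i))

Δ-∘-permute : (π : Permutation′ n) (κ κ′ : Fin n → Fin k) →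
  Δ κ′ (κ ∘ (π ⟨$⟩ʳ_)) ≡ Δ κ (κ′ ∘ (π ⟨$⟩ˡ_))
Δ-∘-permute {n} π κ κ′ = begin
  Δ κ′ (κ ∘ (π ⟨$⟩ʳ_))                                   ≡⟨ Δ-sym κ′ _ ⟩
  product (λ i → δ (κ (π ⟨$⟩ʳ i)) (κ′ i))                 ≡⟨ product-cong-≗ {n} (λ i → cong (δ (κ (π ⟨$⟩ʳ i)) ∘ κ′) (inverseˡ π)) ⟨
  product (λ i → δ (κ (π ⟨$⟩ʳ i)) (κ′ (π ⟨$⟩ˡ (π ⟨$⟩ʳ i)))) ≡⟨ ∏-permute (λ j → δ (κ j) (κ′ (π ⟨$⟩ˡ j))) π ⟨
  Δ κ (κ′ ∘ (π ⟨$⟩ˡ_))                                   ∎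
  where open ≡-Reasoning

-- Opaque, so that the type checker never unfolds a sum over all colourings.
opaque
  ∑F : ∀ n → ((Fin n → Fin k) → ℕ) → ℕ
  ∑F zero F = F (λ ())
  ∑F {k} (suc n) F = ∑[ c < k ] ∑F n (λ κ → F (consF c κ))

  ∑F-cong : ∀ n {F G : (Fin n → Fin k) → ℕ} → (∀ κ → F κ ≡ G κ) → ∑F n F ≡ ∑F n G
  ∑F-cong zero F≡G = F≡G _
  ∑F-cong (suc n) F≡G = sum-cong-≗ (λ c → ∑F-cong n (F≡G ∘ consF c))

  ∑F-distrib-+ : ∀ n (F G : (Fin n → Fin k) → ℕ) → ∑F n (λ κ → F κ + G κ) ≡ ∑F n F + ∑F n G
  ∑F-distrib-+ zero F G = refl
  ∑F-distrib-+ {k} (suc n) F G =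
    trans (sum-cong-≗ (λ c → ∑F-distrib-+ n (F ∘ consF c) (G ∘ consF c))) (∑-distrib-+ {k} _ _)

  *-distribˡ-∑F : ∀ n x (F : (Fin n → Fin k) → ℕ) → x * ∑F n F ≡ ∑F n (λ κ → x * F κ)
  *-distribˡ-∑F zero x F = refl
  *-distribˡ-∑F {k} (suc n) x F =
    trans (*-distribˡ-sum {k} x _) (sum-cong-≗ (λ c → *-distribˡ-∑F n x (F ∘ consF c)))

  ∑-∑F-comm : ∀ m n (F : Fin m → (Fin n → Fin k) → ℕ) →
    ∑[ i < m ] ∑F n (F i) ≡ ∑F n (λ κ → ∑[ i < m ] F i κ)
  ∑-∑F-comm m zero F = refl
  ∑-∑F-comm {k} m (suc n) F =
    trans (∑-comm {m} {k} _) (sum-cong-≗ (λ c → ∑-∑F-comm m n (λ i → F i ∘ consF c)))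

  ∑F-comm : ∀ {l} m n (F : (Fin m → Fin l) → (Fin n → Fin k) → ℕ) →
    ∑F m (λ κ → ∑F n (F κ)) ≡ ∑F n (λ λ′ → ∑F m (λ κ → F κ λ′))
  ∑F-comm zero n F = refl
  ∑F-comm {l = l} (suc m) n F =
    trans (sum-cong-≗ (λ c → ∑F-comm m n (F ∘ consF c))) (∑-∑F-comm l n _)

  ∑F-mono-≤ : ∀ n {F G : (Fin n → Fin k) → ℕ} → (∀ κ → F κ ≤ G κ) → ∑F n F ≤ ∑F n G
  ∑F-mono-≤ zero F≤G = F≤G _
  ∑F-mono-≤ (suc n) F≤G = ∑-mono-≤ (λ c → ∑F-mono-≤ n (F≤G ∘ consF c))

  ∑F-zero : ∀ n (F : (Fin n → Fin k) → ℕ) → (∀ κ → F κ ≡ 0) → ∑F n F ≡ 0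
  ∑F-zero zero F F≡0 = F≡0 _
  ∑F-zero (suc n) F F≡0 = ∑-zero _ (λ c → ∑F-zero n (F ∘ consF c) (F≡0 ∘ consF c))

  ∑F-Δ : ∀ n (t : Fin n → Fin k) (F : (Fin n → Fin k) → ℕ) → Extensional F →
    ∑F n (λ κ → Δ κ t * F κ) ≡ F t
  ∑F-Δ zero t F ext = trans (+-identityʳ _) (ext (λ ()))
  ∑F-Δ {k} (suc n) t F ext = begin
    ∑[ c < k ] ∑F n (λ κ → δ c (t zero) * Δ κ (t ∘ suc) * F (consF c κ))
      ≡⟨ sum-cong-≗ (λ c → ∑F-cong n (λ κ → *-assoc (δ c (t zero)) _ _)) ⟩
    ∑[ c < k ] ∑F n (λ κ → δ c (t zero) * (Δ κ (t ∘ suc) * F (consF c κ)))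
      ≡⟨ sum-cong-≗ (λ c → sym (*-distribˡ-∑F n (δ c (t zero)) _)) ⟩
    ∑[ c < k ] (δ c (t zero) * ∑F n (λ κ → Δ κ (t ∘ suc) * F (consF c κ)))
      ≡⟨ ∑-δˡ (t zero) _ ⟩
    ∑F n (λ κ → Δ κ (t ∘ suc) * F (consF (t zero) κ))
      ≡⟨ ∑F-Δ n (t ∘ suc) _ (ext ∘ consF-cong (t zero)) ⟩
    F (consF (t zero) (t ∘ suc))
      ≡⟨ ext (consF-η t) ⟩
    F t ∎
    where open ≡-Reasoning

  length-filterᵇ-allFuns : ∀ n (p : (Fin n → Fin k) → Bool) → (∀ {κ κ′} → κ ≗ κ′ → p κ ≡ p κ′) →
    length (filterᵇ p (allFuns n k)) ≡ ∑F n (⟦_⟧ ∘ p)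
  length-filterᵇ-allFuns zero p p-ext = trans (length-filterᵇ-[ p ] _) (cong ⟦_⟧ (p-ext (λ ())))
  length-filterᵇ-allFuns {k} (suc n) p p-ext =
    trans (length-filterᵇ-concatMap-tabulate p (λ c → map (consF c) (allFuns n k)) id)
          (sum-cong-≗ (λ c → trans (length-filterᵇ-map p (consF c) (allFuns n k))
                                   (length-filterᵇ-allFuns n (p ∘ consF c) (p-ext ∘ consF-cong c))))

*-distribʳ-∑F : ∀ n x (F : (Fin n → Fin k) → ℕ) → ∑F n F * x ≡ ∑F n (λ κ → F κ * x)
*-distribʳ-∑F n x F = trans (*-comm _ x) (trans (*-distribˡ-∑F n x F) (∑F-cong n (λ κ → *-comm x (F κ))))

∑F-≥ : ∀ n (t : Fin n → Fin k) (F : (Fin n → Fin k) → ℕ) → Extensional F → F t ≤ ∑F n F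
∑F-≥ n t F ext = subst (_≤ ∑F n F) (∑F-Δ n t F ext)
  (∑F-mono-≤ n (λ κ → ≤-trans (*-monoˡ-≤ (F κ) (Δ-≤1 κ t)) (≤-reflexive (+-identityʳ (F κ)))))

∑F-∘-permute : ∀ n (π : Permutation′ n) (F : (Fin n → Fin k) → ℕ) → Extensional F →
  ∑F n (λ κ → F (κ ∘ (π ⟨$⟩ʳ_))) ≡ ∑F n F
∑F-∘-permute n π F ext = begin
  ∑F n (λ κ → F (κ ∘ (π ⟨$⟩ʳ_)))                          ≡⟨ ∑F-cong n (λ κ → ∑F-Δ n (κ ∘ (π ⟨$⟩ʳ_)) F ext) ⟨
  ∑F n (λ κ → ∑F n (λ κ′ → Δ κ′ (κ ∘ (π ⟨$⟩ʳ_)) * F κ′))  ≡⟨ ∑F-comm n n _ ⟩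
  ∑F n (λ κ′ → ∑F n (λ κ → Δ κ′ (κ ∘ (π ⟨$⟩ʳ_)) * F κ′))  ≡⟨ ∑F-cong n (λ κ′ → ∑F-cong n (λ κ → cong (_* F κ′) (Δ-∘-permute π κ κ′))) ⟩
  ∑F n (λ κ′ → ∑F n (λ κ → Δ κ (κ′ ∘ (π ⟨$⟩ˡ_)) * F κ′))  ≡⟨ ∑F-cong n (λ κ′ → ∑F-Δ n _ (λ _ → F κ′) (λ _ → refl)) ⟩
  ∑F n F                                                  ∎
  where open ≡-Reasoning

-- Colourings and their coincidences

-- Every monochromatic edge is counted twice, once for each orientation.
monochromaticEdges : Graph n → (Fin n → Fin k) → ℕ
monochromaticEdges {n} G κ = ∑[ u < n ] ∑[ v < n ] (⟦ adj G u v ⟧ * δ (κ u) (κ v))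

monochromaticEdges-cong : (G : Graph n) {κ κ′ : Fin n → Fin k} → κ ≗ κ′ →
  monochromaticEdges G κ ≡ monochromaticEdges G κ′
monochromaticEdges-cong G κ≗κ′ =
  sum-cong-≗ (λ u → sum-cong-≗ (λ v → cong₂ (λ a b → ⟦ adj G u v ⟧ * δ a b) (κ≗κ′ u) (κ≗κ′ v)))

isProper-≡ᵇ : (G : Graph n) (κ : Fin n → Fin k) → isProper G κ ≡ (monochromaticEdges G κ ≡ᵇ 0)
isProper-≡ᵇ {n} G κ = Bool-ext
  (λ proper → ≡ᵇ0⁺ (∑-zero {n} _ λ u → ∑-zero {n} _ λ v → clash-free⇒ u v (proper⇒ proper u v)))
  (λ mono≡ᵇ0 → ⇒proper (λ u v → ⇒clash-free u v (∑-zero⁻ _ (∑-zero⁻ _ (≡ᵇ0⁻ mono≡ᵇ0) u) v)))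
  where
  clash : Fin n → Fin n → Bool
  clash u v = adj G u v ∧ does (κ u ≟ κ v)
  check : Fin n → Fin n → Bool
  check u v = if adj G u v then (if does (κ u ≟ κ v) then false else true) else true
  check≡ : ∀ u v → check u v ≡ not (clash u v)
  check≡ u v with adj G u v | does (κ u ≟ κ v)
  ... | true | true = refl
  ... | true | false = refl
  ... | false | _ = refl
  isProper≡ : isProper G κ ≡ and (map (λ u → and (map (check u) (allFin n))) (allFin n))
  isProper≡ = and-concatMap (λ u → map (check u) (allFin n)) (allFin n)
  proper⇒ : isProper G κ ≡ true → ∀ u v → check u v ≡ true
  proper⇒ proper u = and-tabulate⁻ (check u) id (and-tabulate⁻ _ id (trans (sym isProper≡) proper) u)
  ⇒proper : (∀ u v → check u v ≡ true) → isProper G κ ≡ true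
  ⇒proper checks = trans isProper≡ (and-tabulate⁺ _ id (λ u → and-tabulate⁺ (check u) id (checks u)))
  clash-free⇒ : ∀ u v → check u v ≡ true → ⟦ adj G u v ⟧ * δ (κ u) (κ v) ≡ 0
  clash-free⇒ u v ok rewrite sym (⟦∧⟧ (adj G u v) (does (κ u ≟ κ v))) | check≡ u v with clash u v
  ... | false = refl
  ⇒clash-free : ∀ u v → ⟦ adj G u v ⟧ * δ (κ u) (κ v) ≡ 0 → check u v ≡ true
  ⇒clash-free u v none rewrite sym (⟦∧⟧ (adj G u v) (does (κ u ≟ κ v))) | check≡ u v with clash u v
  ... | false = refl
  ≡ᵇ0⁺ : ∀ {x} → x ≡ 0 → (x ≡ᵇ 0) ≡ true
  ≡ᵇ0⁺ refl = refl
  ≡ᵇ0⁻ : ∀ {x} → (x ≡ᵇ 0) ≡ true → x ≡ 0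
  ≡ᵇ0⁻ {zero} _ = refl

isProper-cong : (G : Graph n) {κ κ′ : Fin n → Fin k} → κ ≗ κ′ → isProper G κ ≡ isProper G κ′
isProper-cong G {κ} {κ′} κ≗κ′ =
  trans (isProper-≡ᵇ G κ) (trans (cong (_≡ᵇ 0) (monochromaticEdges-cong G κ≗κ′)) (sym (isProper-≡ᵇ G κ′)))

adj-irreflexive : (G : Graph n) {u v : Fin n} → adj G u v ≡ true → u ≢ v
adj-irreflexive G {u} uv refl with trans (sym uv) (irrefl G u)
... | ()

classSize : (Fin n → Fin k) → Fin k → ℕ
classSize {n} κ c = ∑[ v < n ] δ (κ v) c

classSize-cong : {κ κ′ : Fin n → Fin k} → κ ≗ κ′ → classSize κ ≗ classSize κ′
classSize-cong κ≗κ′ c = sum-cong-≗ (λ v → cong (λ a → δ a c) (κ≗κ′ v))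

classSize-≤ : (κ : Fin n → Fin k) (c : Fin k) → classSize κ c ≤ n
classSize-≤ {n} κ c = ≤-trans (∑-mono-≤ (λ v → δ-≤1 (κ v) c)) (≤-reflexive (∑-one n))

hasType⁺ : (κ : Fin n → Fin k) (α : Fin k → ℕ) → classSize κ ≗ α → hasType κ α ≡ true
hasType⁺ κ α sizes = and-tabulate⁺ _ id (λ c → dec-true (_ ≟ℕ α c) (trans (countFin-∑ (λ v → does (κ v ≟ c))) (sizes c)))

hasType⁻ : (κ : Fin n → Fin k) (α : Fin k → ℕ) → hasType κ α ≡ true → classSize κ ≗ α
hasType⁻ κ α type c = trans (sym (countFin-∑ (λ v → does (κ v ≟ c)))) (does-true⁻ (_ ≟ℕ α c) (and-tabulate⁻ _ id type c))

hasType-cong : {κ κ′ : Fin n → Fin k} (α : Fin k → ℕ) → κ ≗ κ′ → hasType κ α ≡ hasType κ′ α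
hasType-cong {κ = κ} {κ′} α κ≗κ′ = Bool-ext
  (λ type → hasType⁺ κ′ α (λ c → trans (sym (classSize-cong κ≗κ′ c)) (hasType⁻ κ α type c)))
  (λ type → hasType⁺ κ α (λ c → trans (classSize-cong κ≗κ′ c) (hasType⁻ κ′ α type c)))

∑-classSize : (κ : Fin n → Fin k) → ∑[ c < k ] classSize κ c ≡ n
∑-classSize {n} {k} κ = trans (∑-comm {k} {n} _) (trans (sum-cong-≗ (λ v → ∑-δ-one (κ v))) (∑-one n))

classSize-∘-permute : (π : Permutation′ n) (κ : Fin n → Fin k) → classSize (κ ∘ (π ⟨$⟩ʳ_)) ≗ classSize κ
classSize-∘-permute π κ c = sym (∑-permute (λ v → δ (κ v) c) π)

coincidences : (Fin n → Fin k) → ℕ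
coincidences {n} κ = ∑[ u < n ] ∑[ v < n ] (⟦ not (does (u ≟ v)) ⟧ * δ (κ u) (κ v))

coincidences-cong : {κ κ′ : Fin n → Fin k} → κ ≗ κ′ → coincidences κ ≡ coincidences κ′
coincidences-cong κ≗κ′ = sum-cong-≗ (λ u → sum-cong-≗ (λ v → cong₂ (λ a b → ⟦ not (does (u ≟ v)) ⟧ * δ a b) (κ≗κ′ u) (κ≗κ′ v)))

∑-classSize² : (κ : Fin n → Fin k) → ∑[ c < k ] (classSize κ c * classSize κ c) ≡ n + coincidences κ
∑-classSize² {n} {k} κ = begin
  ∑[ c < k ] (classSize κ c * classSize κ c)
    ≡⟨ sum-cong-≗ (λ c → trans (*-distribʳ-sum {n} (classSize κ c) _) (sum-cong-≗ (λ u → *-distribˡ-sum {n} (δ (κ u) c) _))) ⟩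
  ∑[ c < k ] ∑[ u < n ] ∑[ v < n ] (δ (κ u) c * δ (κ v) c)
    ≡⟨ trans (∑-comm {k} {n} _) (sum-cong-≗ {n} (λ u → ∑-comm {k} {n} _)) ⟩
  ∑[ u < n ] ∑[ v < n ] ∑[ c < k ] (δ (κ u) c * δ (κ v) c)
    ≡⟨ sum-cong-≗ (λ u → sum-cong-≗ (λ v → trans (∑-δ (κ u) _) (δ-sym (κ v) (κ u)))) ⟩
  ∑[ u < n ] ∑[ v < n ] δ (κ u) (κ v)
    ≡⟨ sum-cong-≗ (λ u → trans (sum-cong-≗ (λ v → diagonal-split u v)) (∑-distrib-+ {n} _ _)) ⟩
  ∑[ u < n ] (∑[ v < n ] (δ u v * δ (κ u) (κ v)) + ∑[ v < n ] (⟦ not (does (u ≟ v)) ⟧ * δ (κ u) (κ v)))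
    ≡⟨ ∑-distrib-+ {n} _ _ ⟩
  ∑[ u < n ] ∑[ v < n ] (δ u v * δ (κ u) (κ v)) + coincidences κ
    ≡⟨ cong (_+ coincidences κ) (trans (sum-cong-≗ (λ u → trans (∑-δ u _) (δ-refl (κ u)))) (∑-one n)) ⟩
  n + coincidences κ ∎
  where
  open ≡-Reasoning
  diagonal-split : ∀ u v → δ (κ u) (κ v) ≡ δ u v * δ (κ u) (κ v) + ⟦ not (does (u ≟ v)) ⟧ * δ (κ u) (κ v)
  diagonal-split u v with does (u ≟ v)
  ... | true = sym (trans (+-identityʳ _) (+-identityʳ _))
  ... | false = sym (+-identityʳ _)

coincidences-∘-permute : (π : Permutation′ n) (κ : Fin n → Fin k) →
  coincidences (κ ∘ (π ⟨$⟩ʳ_)) ≡ coincidences κ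
coincidences-∘-permute {n} π κ = +-cancelˡ-≡ n _ _ (begin
  n + coincidences (κ ∘ (π ⟨$⟩ʳ_))                          ≡⟨ ∑-classSize² (κ ∘ (π ⟨$⟩ʳ_)) ⟨
  ∑[ c < _ ] (classSize (κ ∘ (π ⟨$⟩ʳ_)) c * classSize (κ ∘ (π ⟨$⟩ʳ_)) c)
    ≡⟨ sum-cong-≗ (λ c → cong₂ _*_ (classSize-∘-permute π κ c) (classSize-∘-permute π κ c)) ⟩
  ∑[ c < _ ] (classSize κ c * classSize κ c)              ≡⟨ ∑-classSize² κ ⟩
  n + coincidences κ                                     ∎)
  where open ≡-Reasoning

monochromaticEdges-even : (G : Graph n) (κ : Fin n → Fin k) →
  ∃ λ m → monochromaticEdges G κ ≡ 2 * m × 2 * m ≤ coincidences κ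
monochromaticEdges-even {n} G κ with ∑∑-even n _ f-sym (λ u → cong (λ b → ⟦ b ⟧ * _) (irrefl G u))
  where f-sym : ∀ u v → ⟦ adj G u v ⟧ * δ (κ u) (κ v) ≡ ⟦ adj G v u ⟧ * δ (κ v) (κ u)
        f-sym u v = cong₂ (λ b d → ⟦ b ⟧ * d) (adj-sym G u v) (δ-sym (κ u) (κ v))
... | m , mono≡ = m , mono≡ , subst (_≤ coincidences κ) mono≡
  (∑-mono-≤ (λ u → ∑-mono-≤ (λ v → *-monoˡ-≤ (δ (κ u) (κ v)) (adj≤distinct u v))))
  where
  adj≤distinct : ∀ u v → ⟦ adj G u v ⟧ ≤ ⟦ not (does (u ≟ v)) ⟧
  adj≤distinct u v with adj G u v in uv
  ... | false = z≤n
  ... | true rewrite dec-false (u ≟ v) (adj-irreflexive G uv) = ≤-refl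

proper-with-two-coincidences : (G : Graph n) (κ : Fin n → Fin k) → coincidences κ ≡ 2 →
  2 * ⟦ isProper G κ ⟧ + monochromaticEdges G κ ≡ 2
proper-with-two-coincidences G κ two rewrite isProper-≡ᵇ G κ
  with monochromaticEdges-even G κ
... | m , mono≡ , bound rewrite mono≡ | two = check m (*-cancelˡ-≤ 2 bound)
  where
  check : ∀ m → m ≤ 1 → 2 * ⟦ 2 * m ≡ᵇ 0 ⟧ + 2 * m ≡ 2
  check 0 _ = refl
  check 1 _ = refl
  check (suc (suc _)) (s≤s ())

-- Here the number m of monochromatic edges is 0, 2 or 4, and 8 [m = 0] + 6 m = 8 + m² on these values.
proper-with-four-coincidences : (G : Graph n) (κ : Fin n → Fin k) → coincidences κ ≡ 4 →
  8 * ⟦ isProper G κ ⟧ + 6 * monochromaticEdges G κ ≡ 8 + monochromaticEdges G κ * monochromaticEdges G κ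
proper-with-four-coincidences G κ four rewrite isProper-≡ᵇ G κ
  with monochromaticEdges-even G κ
... | m , mono≡ , bound rewrite mono≡ | four = check m (*-cancelˡ-≤ 2 bound)
  where
  check : ∀ m → m ≤ 2 → 8 * ⟦ 2 * m ≡ᵇ 0 ⟧ + 6 * (2 * m) ≡ 8 + 2 * m * (2 * m)
  check 0 _ = refl
  check 1 _ = refl
  check 2 _ = refl
  check (suc (suc (suc _))) (s≤s (s≤s ()))

coincidences-suc : (κ : Fin (suc n) → Fin k) →
  coincidences κ ≡ 2 * ∑[ v < n ] δ (κ zero) (κ (suc v)) + coincidences (κ ∘ suc)
coincidences-suc {n} κ = begin
  (0 + ∑[ v < n ] (δ (κ zero) (κ (suc v)) + 0))
    + ∑[ u < n ] ((δ (κ (suc u)) (κ zero) + 0) + ∑[ v < n ] (⟦ not (does (u ≟ v)) ⟧ * δ (κ (suc u)) (κ (suc v))))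
    ≡⟨ cong₂ _+_ (sum-cong-≗ {n} (λ v → +-identityʳ (δ (κ zero) (κ (suc v))))) (∑-distrib-+ {n} _ _) ⟩
  row + (∑[ u < n ] (δ (κ (suc u)) (κ zero) + 0) + coincidences (κ ∘ suc))
    ≡⟨ cong (λ x → row + (x + coincidences (κ ∘ suc))) (sum-cong-≗ (λ u → trans (+-identityʳ _) (δ-sym (κ (suc u)) (κ zero)))) ⟩
  row + (row + coincidences (κ ∘ suc))
    ≡⟨ +-assoc row row _ ⟨
  row + row + coincidences (κ ∘ suc)
    ≡⟨ cong (λ x → row + x + coincidences (κ ∘ suc)) (+-identityʳ row) ⟨
  2 * row + coincidences (κ ∘ suc) ∎
  where
  open ≡-Reasoning
  row : ℕ
  row = ∑[ v < n ] δ (κ zero) (κ (suc v))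

coincidences-injective : (κ : Fin n → Fin k) → Injective _≡_ _≡_ κ → coincidences κ ≡ 0
coincidences-injective κ κ-inj = ∑-zero _ (λ u → ∑-zero _ (λ v → distinct u v))
  where
  distinct : ∀ u v → ⟦ not (does (u ≟ v)) ⟧ * δ (κ u) (κ v) ≡ 0
  distinct u v with u ≟ v
  ... | yes _ = refl
  ... | no u≢v = trans (+-identityʳ _) (δ-≢ (u≢v ∘ κ-inj))

merge₂ : ∀ {r} → Fin (2 + r) → Fin (2 + r)
merge₂ zero = zero
merge₂ (suc zero) = zero
merge₂ (suc (suc i)) = suc (suc i)

merge₄ : ∀ {r} → Fin (4 + r) → Fin (4 + r)
merge₄ zero = zero
merge₄ (suc zero) = zero
merge₄ (suc (suc zero)) = suc zero
merge₄ (suc (suc (suc zero))) = suc zero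
merge₄ (suc (suc (suc (suc i)))) = suc (suc (suc (suc i)))

coincidences-merge₂ : ∀ r → coincidences (merge₂ {r}) ≡ 2
coincidences-merge₂ r = begin
  coincidences (merge₂ {r})
    ≡⟨ coincidences-suc (merge₂ {r}) ⟩
  2 * (1 + ∑[ i < r ] 0) + coincidences (λ i → merge₂ {r} (suc i))
    ≡⟨ cong₂ (λ a b → 2 * (1 + a) + b) (∑-zeros r) (coincidences-suc (λ i → merge₂ {r} (suc i))) ⟩
  2 + (2 * ∑[ i < r ] 0 + coincidences (λ i → merge₂ {r} (suc (suc i))))
    ≡⟨ cong₂ (λ a b → 2 + (2 * a + b)) (∑-zeros r) (coincidences-injective (λ i → merge₂ {r} (suc (suc i))) (suc-injective ∘ suc-injective)) ⟩
  2 ∎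
  where open ≡-Reasoning

coincidences-merge₄ : ∀ r → coincidences (merge₄ {r}) ≡ 4
coincidences-merge₄ r = begin
  coincidences (merge₄ {r})
    ≡⟨ coincidences-suc (merge₄ {r}) ⟩
  2 * (1 + ∑[ i < r ] 0) + coincidences (λ i → merge₄ {r} (suc i))
    ≡⟨ cong₂ (λ a b → 2 * (1 + a) + b) (∑-zeros r) (coincidences-suc (λ i → merge₄ {r} (suc i))) ⟩
  2 + (2 * ∑[ i < r ] 0 + coincidences (λ i → merge₄ {r} (suc (suc i))))
    ≡⟨ cong₂ (λ a b → 2 + (2 * a + b)) (∑-zeros r) (coincidences-suc (λ i → merge₄ {r} (suc (suc i)))) ⟩
  2 + (2 * (1 + ∑[ i < r ] 0) + coincidences (λ i → merge₄ {r} (suc (suc (suc i)))))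
    ≡⟨ cong₂ (λ a b → 2 + (2 * (1 + a) + b)) (∑-zeros r) (coincidences-suc (λ i → merge₄ {r} (suc (suc (suc i))))) ⟩
  4 + (2 * ∑[ i < r ] 0 + coincidences (λ i → merge₄ {r} (suc (suc (suc (suc i))))))
    ≡⟨ cong₂ (λ a b → 4 + (2 * a + b)) (∑-zeros r)
             (coincidences-injective (λ i → merge₄ {r} (suc (suc (suc (suc i))))) (suc-injective ∘ suc-injective ∘ suc-injective ∘ suc-injective)) ⟩
  4 ∎
  where open ≡-Reasoning

m+6≤m*m : ∀ m → 3 ≤ m → m + 6 ≤ m * m
m+6≤m*m m 3≤m = ≤-trans (+-monoʳ-≤ m (+-mono-≤ 3≤m (≤-trans 3≤m (m≤m+n m 0)))) (*-monoˡ-≤ m 3≤m)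

coincidences-≥6 : (κ : Fin n → Fin k) {p q s : Fin n} → p ≢ q → p ≢ s → q ≢ s →
  κ p ≡ κ q → κ p ≡ κ s → 6 ≤ coincidences κ
coincidences-≥6 {n} {k} κ {p} {q} {s} p≢q p≢s q≢s κp≡κq κp≡κs = +-cancelˡ-≤ n 6 _ (begin
  n + 6                                              ≡⟨ cong₂ _+_ (∑-classSize κ) (∑-δ (κ p) (λ _ → 6)) ⟨
  ∑[ c < k ] classSize κ c + ∑[ c < k ] (δ (κ p) c * 6) ≡⟨ ∑-distrib-+ {k} _ _ ⟨
  ∑[ c < k ] (classSize κ c + δ (κ p) c * 6)            ≤⟨ ∑-mono-≤ bound ⟩
  ∑[ c < k ] (classSize κ c * classSize κ c)            ≡⟨ ∑-classSize² κ ⟩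
  n + coincidences κ                                 ∎)
  where
  open ≤-Reasoning
  three≤ : 3 ≤ classSize κ (κ p)
  three≤ = subst (_≤ classSize κ (κ p))
    (cong₂ _+_ (cong₂ _+_ (δ-refl (κ p)) (trans (cong (λ c → δ c (κ p)) (sym κp≡κq)) (δ-refl (κ p))))
               (trans (cong (λ c → δ c (κ p)) (sym κp≡κs)) (δ-refl (κ p))))
    (∑-≥-three (λ v → δ (κ v) (κ p)) p≢q p≢s q≢s)
  bound : ∀ c → classSize κ c + δ (κ p) c * 6 ≤ classSize κ c * classSize κ c
  bound c with κ p ≟ c
  ... | yes refl = m+6≤m*m _ three≤
  ... | no _ = ≤-trans (≤-reflexive (+-identityʳ _)) (m≤m*m (classSize κ c))
    where
    m≤m*m : ∀ m → m ≤ m * m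
    m≤m*m zero = z≤n
    m≤m*m m@(suc _) = m≤m*n m m

-- Proper colourings counted by the chromatic symmetric function

cgCoeff-∑F : (G : Graph n) (k : ℕ) (α : Fin k → ℕ) →
  cgCoeff G k α ≡ ∑F n (λ κ → ⟦ isProper G κ ⟧ * ⟦ hasType κ α ⟧)
cgCoeff-∑F {n} G k α =
  trans (length-filterᵇ-allFuns n _ (λ κ≗κ′ → cong₂ _∧_ (isProper-cong G κ≗κ′) (hasType-cong α κ≗κ′)))
        (∑F-cong n (λ κ → ⟦∧⟧ (isProper G κ) (hasType κ α)))

classSizes : (Fin n → Fin k) → Fin k → Fin (suc n)
classSizes κ c = fromℕ< (s≤s (classSize-≤ κ c))

hasType-Δ : (κ : Fin n → Fin k) (β : Fin k → Fin (suc n)) → ⟦ hasType κ (toℕ ∘ β) ⟧ ≡ Δ β (classSizes κ)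
hasType-Δ κ = Δ-indicator (hasType κ ∘ (toℕ ∘_)) (classSizes κ)
  (λ β type c → toℕ-injective (trans (sym (hasType⁻ κ _ type c)) (sym (toℕ-fromℕ< _))))
  (λ β β≗ → hasType⁺ κ _ (λ c → trans (sym (toℕ-fromℕ< _)) (cong toℕ (sym (β≗ c)))))

-- Class sizes are at most n, so exponent vectors can be enumerated as maps Fin k → Fin (suc n).
∑F-cgCoeff : (G : Graph n) (g : (Fin k → ℕ) → ℕ) → (∀ {α α′} → α ≗ α′ → g α ≡ g α′) →
  ∑F k (λ β → cgCoeff G k (toℕ ∘ β) * g (toℕ ∘ β)) ≡ ∑F n (λ κ → ⟦ isProper G κ ⟧ * g (classSize κ))
∑F-cgCoeff {n} {k} G g g-cong = begin
  ∑F k (λ β → cgCoeff G k (toℕ ∘ β) * g (toℕ ∘ β))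
    ≡⟨ ∑F-cong k (λ β → trans (cong (_* g (toℕ ∘ β)) (cgCoeff-∑F G k _)) (*-distribʳ-∑F n _ _)) ⟩
  ∑F k (λ β → ∑F n (λ κ → ⟦ isProper G κ ⟧ * ⟦ hasType κ (toℕ ∘ β) ⟧ * g (toℕ ∘ β)))
    ≡⟨ ∑F-comm k n _ ⟩
  ∑F n (λ κ → ∑F k (λ β → ⟦ isProper G κ ⟧ * ⟦ hasType κ (toℕ ∘ β) ⟧ * g (toℕ ∘ β)))
    ≡⟨ ∑F-cong n (λ κ → trans (∑F-cong k (λ β → *-assoc ⟦ isProper G κ ⟧ _ _)) (sym (*-distribˡ-∑F k ⟦ isProper G κ ⟧ _))) ⟩
  ∑F n (λ κ → ⟦ isProper G κ ⟧ * ∑F k (λ β → ⟦ hasType κ (toℕ ∘ β) ⟧ * g (toℕ ∘ β)))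
    ≡⟨ ∑F-cong n (λ κ → cong (⟦ isProper G κ ⟧ *_) (sizes-only κ)) ⟩
  ∑F n (λ κ → ⟦ isProper G κ ⟧ * g (classSize κ)) ∎
  where
  open ≡-Reasoning
  sizes-only : ∀ κ → ∑F k (λ β → ⟦ hasType κ (toℕ ∘ β) ⟧ * g (toℕ ∘ β)) ≡ g (classSize κ)
  sizes-only κ = begin
    ∑F k (λ β → ⟦ hasType κ (toℕ ∘ β) ⟧ * g (toℕ ∘ β))
      ≡⟨ ∑F-cong k (λ β → cong (_* g (toℕ ∘ β)) (hasType-Δ κ β)) ⟩
    ∑F k (λ β → Δ β (classSizes κ) * g (toℕ ∘ β))
      ≡⟨ ∑F-Δ k (classSizes κ) (g ∘ (toℕ ∘_)) (λ β≗β′ → g-cong (cong toℕ ∘ β≗β′)) ⟩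
    g (toℕ ∘ classSizes κ)
      ≡⟨ g-cong (λ c → toℕ-fromℕ< _) ⟩
    g (classSize κ) ∎

properColourings : Graph n → ℕ → ℕ
properColourings {n} G j = ∑F {n} n (λ κ → ⟦ isProper G κ ⟧ * ⟦ coincidences κ ≡ᵇ j ⟧)

properColourings-determined : (G H : Graph n) → SameCSF G H → ∀ j → properColourings G j ≡ properColourings H j
properColourings-determined {n} G H same j = begin
  properColourings G j                                                   ≡⟨ by-sizes G ⟩
  ∑F {n} n (λ κ → ⟦ isProper G κ ⟧ * g (classSize κ))                     ≡⟨ ∑F-cgCoeff G g g-cong ⟨
  ∑F n (λ β → cgCoeff G n (toℕ ∘ β) * g (toℕ ∘ β))                      ≡⟨ ∑F-cong n (λ β → cong (_* g (toℕ ∘ β)) (same n (toℕ ∘ β))) ⟩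
  ∑F n (λ β → cgCoeff H n (toℕ ∘ β) * g (toℕ ∘ β))                      ≡⟨ ∑F-cgCoeff H g g-cong ⟩
  ∑F n (λ κ → ⟦ isProper H κ ⟧ * g (classSize κ))                       ≡⟨ by-sizes H ⟨
  properColourings H j                                                   ∎
  where
  open ≡-Reasoning
  g : (Fin n → ℕ) → ℕ
  g α = ⟦ ∑[ c < n ] (α c * α c) ≡ᵇ n + j ⟧
  g-cong : ∀ {α α′} → α ≗ α′ → g α ≡ g α′
  g-cong α≗α′ = cong (λ s → ⟦ s ≡ᵇ n + j ⟧) (sum-cong-≗ (λ c → cong₂ _*_ (α≗α′ c) (α≗α′ c)))
  +-≡ᵇ : ∀ m a b → (m + a ≡ᵇ m + b) ≡ (a ≡ᵇ b)
  +-≡ᵇ zero a b = refl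
  +-≡ᵇ (suc m) a b = +-≡ᵇ m a b
  by-sizes : (G : Graph n) → properColourings G j ≡ ∑F n (λ κ → ⟦ isProper G κ ⟧ * g (classSize κ))
  by-sizes G = ∑F-cong {n} n (λ κ → cong (λ b → ⟦ isProper G κ ⟧ * ⟦ b ⟧)
    (sym (trans (cong (_≡ᵇ n + j) (∑-classSize² κ)) (+-≡ᵇ n (coincidences κ) j))))

isProper-id : (G : Graph n) → isProper G id ≡ true
isProper-id {n} G = trans (isProper-≡ᵇ G id) (cong (_≡ᵇ 0) (∑-zero _ (λ u →
  trans (sum-cong-≗ (λ v → *-comm ⟦ adj G u v ⟧ (δ u v))) (trans (∑-δ u _) (cong ⟦_⟧ (irrefl G u))))))

hasType-id : ∀ n → hasType {n} id (λ _ → 1) ≡ true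
hasType-id n = hasType⁺ {n} id _ (λ c → trans (sum-cong-≗ (λ v → sym (*-identityʳ (δ v c)))) (∑-δˡ c (λ _ → 1)))

-- The identity colouring of G has all classes of size 1, and so must any colouring of H with that type.
vertexCount-determined : {m : ℕ} (G : Graph n) (H : Graph m) → SameCSF G H → n ≡ m
vertexCount-determined {n} {m} G H same with length-filterᵇ≢0 _ (allFuns m n) cgH≢0
  where
  one : Fin n → ℕ
  one _ = 1
  F : (Fin n → Fin n) → ℕ
  F κ = ⟦ isProper G κ ⟧ * ⟦ hasType κ one ⟧
  cgG≥1 : 1 ≤ cgCoeff G n one
  cgG≥1 = subst₂ _≤_ (cong₂ (λ a b → ⟦ a ⟧ * ⟦ b ⟧) (isProper-id G) (hasType-id n)) (sym (cgCoeff-∑F G n one))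
    (∑F-≥ n id F (λ κ≗κ′ → cong₂ (λ a b → ⟦ a ⟧ * ⟦ b ⟧) (isProper-cong G κ≗κ′) (hasType-cong one κ≗κ′)))
  cgH≢0 : cgCoeff H n one ≢ 0
  cgH≢0 cgH≡0 = case subst (1 ≤_) (trans (same n one) cgH≡0) cgG≥1 of λ ()
... | κ , proper∧type = trans (sym (∑-one n)) (trans (sum-cong-≗ (λ c → sym (hasType⁻ κ _ type c))) (∑-classSize κ))
  where
  type : hasType κ (λ _ → 1) ≡ true
  type = ∧-trueʳ (isProper H κ) proper∧type

-- Symmetry under permuting the vertices

transpose-first : (i j : Fin n) → transpose i j ⟨$⟩ʳ i ≡ j
transpose-first i j rewrite dec-true (i ≟ i) refl = refl

transpose-other : {i j k : Fin n} → k ≢ i → k ≢ j → transpose i j ⟨$⟩ʳ k ≡ k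
transpose-other {i = i} {j} {k} k≢i k≢j rewrite dec-false (k ≟ i) k≢i | dec-false (k ≟ j) k≢j = refl

permutation-injective : (π : Permutation′ n) → Injective _≡_ _≡_ (π ⟨$⟩ʳ_)
permutation-injective π {i} {j} πi≡πj = trans (sym (inverseˡ π)) (trans (cong (π ⟨$⟩ˡ_) πi≡πj) (inverseˡ π))

-- Having matched the tails by induction, one transposition fixes the head without moving the tail.
injective-tuples-related : ∀ {m} (t s : Fin m → Fin n) → Injective _≡_ _≡_ t → Injective _≡_ _≡_ s →
  ∃ λ (π : Permutation′ n) → ∀ i → π ⟨$⟩ʳ t i ≡ s i
injective-tuples-related {m = zero} t s _ _ = Permutation.id , λ ()
injective-tuples-related {m = suc m} t s t-inj s-inj
  with injective-tuples-related (t ∘ suc) (s ∘ suc) (suc-injective ∘ t-inj) (suc-injective ∘ s-inj)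
... | π , π∘t≡s = π ∘ₚ transpose (π ⟨$⟩ʳ t zero) (s zero) , λ where
  zero → transpose-first (π ⟨$⟩ʳ t zero) (s zero)
  (suc i) → trans (cong (transpose _ _ ⟨$⟩ʳ_) (π∘t≡s i))
    (transpose-other (λ eq → zero≢suc (t-inj (permutation-injective π (trans (sym eq) (sym (π∘t≡s i))))))
                     (λ eq → zero≢suc (s-inj (sym eq))))

PermutationInvariant : ∀ {m} → ((Fin m → Fin n) → ℕ) → Set
PermutationInvariant {n} Θ = ∀ (π : Permutation′ n) t → Θ ((π ⟨$⟩ʳ_) ∘ t) ≡ Θ t

invariant-constant-on-injective : ∀ {m} (Θ : (Fin m → Fin n) → ℕ) → Extensional Θ → PermutationInvariant Θ →
  ∀ {t s} → Injective _≡_ _≡_ t → Injective _≡_ _≡_ s → Θ t ≡ Θ s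
invariant-constant-on-injective Θ ext inv {t} {s} t-inj s-inj with injective-tuples-related t s t-inj s-inj
... | π , π∘t≡s = trans (sym (inv π t)) (ext π∘t≡s)

tuple₂ : Fin n → Fin n → Fin 2 → Fin n
tuple₂ u v zero = u
tuple₂ u v (suc zero) = v

tuple₄ : Fin n → Fin n → Fin n → Fin n → Fin 4 → Fin n
tuple₄ p q r s zero = p
tuple₄ p q r s (suc zero) = q
tuple₄ p q r s (suc (suc zero)) = r
tuple₄ p q r s (suc (suc (suc zero))) = s

tuple₂-injective : {u v : Fin n} → u ≢ v → Injective _≡_ _≡_ (tuple₂ u v)
tuple₂-injective u≢v {zero} {zero} _ = refl
tuple₂-injective u≢v {zero} {suc zero} u≡v = ⊥-elim (u≢v u≡v)
tuple₂-injective u≢v {suc zero} {zero} v≡u = ⊥-elim (u≢v (sym v≡u))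
tuple₂-injective u≢v {suc zero} {suc zero} _ = refl

tuple₄-injective : {p q r s : Fin n} → p ≢ q → p ≢ r → p ≢ s → q ≢ r → q ≢ s → r ≢ s →
  Injective _≡_ _≡_ (tuple₄ p q r s)
tuple₄-injective {p = p} {q} {r} {s} pq pr ps qr qs rs {i} {j} = go i j
  where
  go : ∀ i j → tuple₄ p q r s i ≡ tuple₄ p q r s j → i ≡ j
  go zero zero _ = refl
  go zero (suc zero) e = ⊥-elim (pq e)
  go zero (suc (suc zero)) e = ⊥-elim (pr e)
  go zero (suc (suc (suc zero))) e = ⊥-elim (ps e)
  go (suc zero) zero e = ⊥-elim (pq (sym e))
  go (suc zero) (suc zero) _ = refl
  go (suc zero) (suc (suc zero)) e = ⊥-elim (qr e)
  go (suc zero) (suc (suc (suc zero))) e = ⊥-elim (qs e)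
  go (suc (suc zero)) zero e = ⊥-elim (pr (sym e))
  go (suc (suc zero)) (suc zero) e = ⊥-elim (qr (sym e))
  go (suc (suc zero)) (suc (suc zero)) _ = refl
  go (suc (suc zero)) (suc (suc (suc zero))) e = ⊥-elim (rs e)
  go (suc (suc (suc zero))) zero e = ⊥-elim (ps (sym e))
  go (suc (suc (suc zero))) (suc zero) e = ⊥-elim (qs (sym e))
  go (suc (suc (suc zero))) (suc (suc zero)) e = ⊥-elim (rs (sym e))
  go (suc (suc (suc zero))) (suc (suc (suc zero))) _ = refl

∑F-coincidences-∘-permute : (π : Permutation′ n) (j : ℕ) (C : (Fin n → Fin n) → ℕ) → Extensional C →
  ∑F n (λ κ → ⟦ coincidences κ ≡ᵇ j ⟧ * C (κ ∘ (π ⟨$⟩ʳ_))) ≡ ∑F n (λ κ → ⟦ coincidences κ ≡ᵇ j ⟧ * C κ)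
∑F-coincidences-∘-permute {n} π j C ext = begin
  ∑F n (λ κ → ⟦ coincidences κ ≡ᵇ j ⟧ * C (κ ∘ (π ⟨$⟩ʳ_)))
    ≡⟨ ∑F-cong n (λ κ → cong (λ c → ⟦ c ≡ᵇ j ⟧ * C (κ ∘ (π ⟨$⟩ʳ_))) (coincidences-∘-permute π κ)) ⟨
  ∑F n (λ κ → ⟦ coincidences (κ ∘ (π ⟨$⟩ʳ_)) ≡ᵇ j ⟧ * C (κ ∘ (π ⟨$⟩ʳ_)))
    ≡⟨ ∑F-∘-permute n π _ (λ κ≗κ′ → cong₂ (λ c x → ⟦ c ≡ᵇ j ⟧ * x) (coincidences-cong κ≗κ′) (ext κ≗κ′)) ⟩
  ∑F n (λ κ → ⟦ coincidences κ ≡ᵇ j ⟧ * C κ) ∎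
  where open ≡-Reasoning

joining : ℕ → Fin n → Fin n → ℕ
joining {n} j u v = ∑F n (λ (κ : Fin n → Fin n) → ⟦ coincidences κ ≡ᵇ j ⟧ * δ (κ u) (κ v))

joining₂ : ℕ → Fin n → Fin n → Fin n → Fin n → ℕ
joining₂ {n} j p q r s =
  ∑F n (λ (κ : Fin n → Fin n) → ⟦ coincidences κ ≡ᵇ j ⟧ * (δ (κ p) (κ q) * δ (κ r) (κ s)))

joining-constant : (j : ℕ) {u v u′ v′ : Fin n} → u ≢ v → u′ ≢ v′ → joining j u v ≡ joining j u′ v′
joining-constant j u≢v u′≢v′ =
  invariant-constant-on-injective (λ t → joining j (t zero) (t (suc zero)))
    (λ t≗t′ → cong₂ (joining j) (t≗t′ zero) (t≗t′ (suc zero)))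
    (λ π t → ∑F-coincidences-∘-permute π j (λ κ → δ (κ (t zero)) (κ (t (suc zero))))
               (λ κ≗κ′ → cong₂ δ (κ≗κ′ _) (κ≗κ′ _)))
    (tuple₂-injective u≢v) (tuple₂-injective u′≢v′)

joining₂-constant : (j : ℕ) {p q r s p′ q′ r′ s′ : Fin n} →
  p ≢ q → p ≢ r → p ≢ s → q ≢ r → q ≢ s → r ≢ s →
  p′ ≢ q′ → p′ ≢ r′ → p′ ≢ s′ → q′ ≢ r′ → q′ ≢ s′ → r′ ≢ s′ →
  joining₂ j p q r s ≡ joining₂ j p′ q′ r′ s′
joining₂-constant j pq pr ps qr qs rs pq′ pr′ ps′ qr′ qs′ rs′ =
  invariant-constant-on-injective (λ t → joining₂ j (t zero) (t (suc zero)) (t (suc (suc zero))) (t (suc (suc (suc zero)))))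
    (λ t≗t′ → trans (cong₂ (λ a b → joining₂ j a b _ _) (t≗t′ _) (t≗t′ _)) (cong₂ (joining₂ j _ _) (t≗t′ _) (t≗t′ _)))
    (λ π t → ∑F-coincidences-∘-permute π j _ (λ κ≗κ′ → cong₂ _*_ (cong₂ δ (κ≗κ′ _) (κ≗κ′ _)) (cong₂ δ (κ≗κ′ _) (κ≗κ′ _))))
    (tuple₄-injective pq pr ps qr qs rs) (tuple₄-injective pq′ pr′ ps′ qr′ qs′ rs′)

joining₂-same : (j : ℕ) (p q : Fin n) → joining₂ j p q p q ≡ joining j p q
joining₂-same {n} j p q = ∑F-cong n (λ κ → cong (⟦ coincidences κ ≡ᵇ j ⟧ *_) (⟦⟧-idem (does (κ p ≟ κ q))))

joining₂-reversed : (j : ℕ) (p q : Fin n) → joining₂ j p q q p ≡ joining j p q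
joining₂-reversed {n} j p q = trans
  (∑F-cong n (λ κ → cong (λ d → ⟦ coincidences κ ≡ᵇ j ⟧ * (δ (κ p) (κ q) * d)) (δ-sym (κ q) (κ p))))
  (joining₂-same j p q)

joining₂-vanishes : {p q r s : Fin n} → (∀ (κ : Fin n → Fin n) → κ p ≡ κ q → κ r ≡ κ s → 6 ≤ coincidences κ) →
  joining₂ 4 p q r s ≡ 0
joining₂-vanishes {n} {p} {q} {r} {s} ≥6 = ∑F-zero n _ vanishes
  where
  not-four : ∀ {x} → 6 ≤ x → (x ≡ᵇ 4) ≡ false
  not-four (s≤s (s≤s (s≤s (s≤s (s≤s (s≤s _)))))) = refl
  vanishes : ∀ κ → ⟦ coincidences κ ≡ᵇ 4 ⟧ * (δ (κ p) (κ q) * δ (κ r) (κ s)) ≡ 0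
  vanishes κ with κ p ≟ κ q | κ r ≟ κ s
  ... | yes κp≡κq | yes κr≡κs rewrite not-four (≥6 κ κp≡κq κr≡κs) = refl
  ... | yes _ | no _ = *-zeroʳ ⟦ coincidences κ ≡ᵇ 4 ⟧
  ... | no _ | _ = *-zeroʳ ⟦ coincidences κ ≡ᵇ 4 ⟧

joining-positive : ∀ r → 1 ≤ joining {2 + r} 2 0F 1F
joining-positive r = subst (_≤ joining {2 + r} 2 0F 1F) (cong (λ c → ⟦ c ≡ᵇ 2 ⟧ * 1) (coincidences-merge₂ r))
  (∑F-≥ (2 + r) merge₂ _ (λ κ≗κ′ → cong₂ (λ c d → ⟦ c ≡ᵇ 2 ⟧ * d) (coincidences-cong κ≗κ′) (cong₂ δ (κ≗κ′ 0F) (κ≗κ′ 1F))))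

joining₂-positive : ∀ t → 1 ≤ joining₂ {4 + t} 4 0F 1F 2F 3F
joining₂-positive t = subst (_≤ joining₂ {4 + t} 4 0F 1F 2F 3F) (cong (λ c → ⟦ c ≡ᵇ 4 ⟧ * 1) (coincidences-merge₄ t))
  (∑F-≥ (4 + t) merge₄ _ (λ κ≗κ′ → cong₂ (λ c d → ⟦ c ≡ᵇ 4 ⟧ * d) (coincidences-cong κ≗κ′)
                                            (cong₂ _*_ (cong₂ δ (κ≗κ′ 0F) (κ≗κ′ 1F)) (cong₂ δ (κ≗κ′ 2F) (κ≗κ′ 3F)))))

degree-∑ : (G : Graph n) (u : Fin n) → degree G u ≡ ∑[ v < n ] ⟦ adj G u v ⟧
degree-∑ G u = countFin-∑ (adj G u)

-- Opaque for the same reason as ∑F.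
opaque
  degreeSum : Graph n → ℕ
  degreeSum {n} G = ∑[ u < n ] degree G u

  squareDegreeSum : Graph n → ℕ
  squareDegreeSum {n} G = ∑[ u < n ] (degree G u * degree G u)

  ∑edges : Graph n → (Fin n → Fin n → ℕ) → ℕ
  ∑edges {n} G f = ∑[ u < n ] ∑[ v < n ] (⟦ adj G u v ⟧ * f u v)

degree² : Graph n → Fin n → ℕ
degree² {n} G u = ∑[ v < n ] ⟦ adj G u v ⟧ * ∑[ v < n ] ⟦ adj G u v ⟧

opaque
  unfolding degreeSum squareDegreeSum

  sumSqDeg-squareDegreeSum : (G : Graph n) → sumSqDeg G ≡ squareDegreeSum G
  sumSqDeg-squareDegreeSum G = sum-map-allFin (λ v → degree G v * degree G v)

  squareDegreeSum-∑ : (G : Graph n) → squareDegreeSum G ≡ ∑[ u < n ] degree² G u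
  squareDegreeSum-∑ G = sum-cong-≗ (λ u → cong₂ _*_ (degree-∑ G u) (degree-∑ G u))

  degreeSum-∑ : (G : Graph n) → degreeSum G ≡ ∑[ u < n ] ∑[ v < n ] ⟦ adj G u v ⟧
  degreeSum-∑ G = sum-cong-≗ (degree-∑ G)

module _ (G : Graph n) where

  opaque
    unfolding ∑edges degreeSum squareDegreeSum


    ∑edges-cong : {f g : Fin n → Fin n → ℕ} → (∀ u v → adj G u v ≡ true → f u v ≡ g u v) → ∑edges G f ≡ ∑edges G g
    ∑edges-cong {f} {g} f≡g = sum-cong-≗ (λ u → sum-cong-≗ (λ v → on-edge u v))
      where
      on-edge : ∀ u v → ⟦ adj G u v ⟧ * f u v ≡ ⟦ adj G u v ⟧ * g u v
      on-edge u v with adj G u v in uv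
      ... | true = cong (_+ 0) (f≡g u v uv)
      ... | false = refl

    ∑edges-distrib-+ : (f g : Fin n → Fin n → ℕ) → ∑edges G (λ u v → f u v + g u v) ≡ ∑edges G f + ∑edges G g
    ∑edges-distrib-+ f g = trans
      (sum-cong-≗ (λ u → trans (sum-cong-≗ (λ v → *-distribˡ-+ ⟦ adj G u v ⟧ (f u v) (g u v))) (∑-distrib-+ {n} _ _)))
      (∑-distrib-+ {n} _ _)

    *-distribˡ-∑edges : ∀ c (f : Fin n → Fin n → ℕ) → c * ∑edges G f ≡ ∑edges G (λ u v → c * f u v)
    *-distribˡ-∑edges c f = trans (*-distribˡ-sum {n} c _)
      (sum-cong-≗ (λ u → trans (*-distribˡ-sum {n} c _) (sum-cong-≗ (λ v → x*[y*z]≡y*[x*z] c ⟦ adj G u v ⟧ (f u v)))))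
      where
      x*[y*z]≡y*[x*z] : ∀ x y z → x * (y * z) ≡ y * (x * z)
      x*[y*z]≡y*[x*z] = solve-∀

    ∑edges-const : ∀ c → ∑edges G (λ _ _ → c) ≡ degreeSum G * c
    ∑edges-const c = begin
      ∑[ u < n ] ∑[ v < n ] (⟦ adj G u v ⟧ * c) ≡⟨ sum-cong-≗ (λ u → *-distribʳ-sum {n} c (λ v → ⟦ adj G u v ⟧)) ⟨
      ∑[ u < n ] (∑[ v < n ] ⟦ adj G u v ⟧ * c) ≡⟨ *-distribʳ-sum {n} c (λ u → ∑[ v < n ] ⟦ adj G u v ⟧) ⟨
      ∑[ u < n ] ∑[ v < n ] ⟦ adj G u v ⟧ * c   ≡⟨ cong (_* c) (sum-cong-≗ (λ u → degree-∑ G u)) ⟨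
      degreeSum G * c                           ∎
      where open ≡-Reasoning

    ∑edges-swap : (f : Fin n → Fin n → ℕ) → ∑edges G f ≡ ∑edges G (λ u v → f v u)
    ∑edges-swap f = trans (∑-comm {n} {n} _) (sum-cong-≗ (λ v → sum-cong-≗ (λ u → cong (λ b → ⟦ b ⟧ * f u v) (adj-sym G u v))))

    ∑edges-δ : ∀ x → ∑edges G (λ u v → δ x u) ≡ degree G x
    ∑edges-δ x = begin
      ∑[ u < n ] ∑[ v < n ] (⟦ adj G u v ⟧ * δ x u) ≡⟨ sum-cong-≗ (λ u → trans (sum-cong-≗ (λ v → *-comm ⟦ adj G u v ⟧ (δ x u)))
                                                                              (sym (*-distribˡ-sum {n} (δ x u) _))) ⟩
      ∑[ u < n ] (δ x u * ∑[ v < n ] ⟦ adj G u v ⟧) ≡⟨ ∑-δ x _ ⟩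
      ∑[ v < n ] ⟦ adj G x v ⟧                     ≡⟨ degree-∑ G x ⟨
      degree G x                                   ∎
      where open ≡-Reasoning

    ∑edges-δδ : ∀ x y → ∑edges G (λ u v → δ x u * δ y v) ≡ ⟦ adj G x y ⟧
    ∑edges-δδ x y = begin
      ∑[ u < n ] ∑[ v < n ] (⟦ adj G u v ⟧ * (δ x u * δ y v))
        ≡⟨ sum-cong-≗ (λ u → trans (sum-cong-≗ (λ v → regroup ⟦ adj G u v ⟧ (δ x u) (δ y v)))
                                   (sym (*-distribˡ-sum {n} (δ x u) _))) ⟩
      ∑[ u < n ] (δ x u * ∑[ v < n ] (δ y v * ⟦ adj G u v ⟧))
        ≡⟨ sum-cong-≗ (λ u → cong (δ x u *_) (∑-δ y _)) ⟩
      ∑[ u < n ] (δ x u * ⟦ adj G u y ⟧)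
        ≡⟨ ∑-δ x _ ⟩
      ⟦ adj G x y ⟧ ∎
      where
      open ≡-Reasoning
      regroup : ∀ a b c → a * (b * c) ≡ b * (c * a)
      regroup = solve-∀

    ∑edges-degree : ∑edges G (λ u v → degree G u) ≡ squareDegreeSum G
    ∑edges-degree = sum-cong-≗ (λ u →
      trans (sym (*-distribʳ-sum {n} (degree G u) (λ v → ⟦ adj G u v ⟧))) (cong (_* degree G u) (sym (degree-∑ G u))))

    ∑edges-degreeSum : ∑edges G (λ u v → ⟦ adj G u v ⟧) ≡ degreeSum G
    ∑edges-degreeSum = begin
      ∑edges G (λ u v → ⟦ adj G u v ⟧) ≡⟨ sum-cong-≗ (λ u → sum-cong-≗ (λ v → trans (⟦⟧-idem (adj G u v)) (sym (*-identityʳ _)))) ⟩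
      ∑edges G (λ _ _ → 1)            ≡⟨ ∑edges-const 1 ⟩
      degreeSum G * 1                 ≡⟨ *-identityʳ _ ⟩
      degreeSum G                     ∎
      where open ≡-Reasoning

    ∑F-monochromaticEdges : (w : (Fin n → Fin k) → ℕ) →
      ∑F n (λ κ → w κ * monochromaticEdges G κ) ≡ ∑edges G (λ u v → ∑F n (λ κ → w κ * δ (κ u) (κ v)))
    ∑F-monochromaticEdges w = begin
      ∑F n (λ κ → w κ * monochromaticEdges G κ)
        ≡⟨ ∑F-cong n (λ κ → trans (*-distribˡ-sum {n} (w κ) _) (sum-cong-≗ (λ u → *-distribˡ-sum {n} (w κ) (λ v → ⟦ adj G u v ⟧ * δ (κ u) (κ v))))) ⟩
      ∑F n (λ κ → ∑[ u < n ] ∑[ v < n ] (w κ * (⟦ adj G u v ⟧ * δ (κ u) (κ v))))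
        ≡⟨ trans (sum-cong-≗ (λ u → ∑-∑F-comm n n (λ v κ → w κ * (⟦ adj G u v ⟧ * δ (κ u) (κ v))))) (∑-∑F-comm n n _) ⟨
      ∑[ u < n ] ∑[ v < n ] ∑F n (λ κ → w κ * (⟦ adj G u v ⟧ * δ (κ u) (κ v)))
        ≡⟨ sum-cong-≗ (λ u → sum-cong-≗ (λ v → trans (∑F-cong n (λ κ → regroup (w κ) ⟦ adj G u v ⟧ _))
                                                    (sym (*-distribˡ-∑F n ⟦ adj G u v ⟧ _)))) ⟩
      ∑edges G (λ u v → ∑F n (λ κ → w κ * δ (κ u) (κ v))) ∎
      where
      open ≡-Reasoning
      regroup : ∀ a b c → a * (b * c) ≡ b * (a * c)
      regroup = solve-∀

    ∑edges-+* : (f g : Fin n → Fin n → ℕ) (c : ℕ) → ∑edges G (λ u v → f u v + c * g u v) ≡ ∑edges G f + c * ∑edges G g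
    ∑edges-+* f g c = trans (∑edges-distrib-+ f _) (cong (∑edges G f +_) (sym (*-distribˡ-∑edges c g)))

    ∑edges-symmetrize : (h : Fin n → ℕ) → ∑edges G (λ u v → h u + h v) ≡ 2 * ∑edges G (λ u v → h u)
    ∑edges-symmetrize h = begin
      ∑edges G (λ u v → h u + h v)                      ≡⟨ ∑edges-distrib-+ (λ u v → h u) (λ u v → h v) ⟩
      ∑edges G (λ u v → h u) + ∑edges G (λ u v → h v)   ≡⟨ cong (∑edges G (λ u v → h u) +_) (∑edges-swap (λ u v → h v)) ⟩
      ∑edges G (λ u v → h u) + ∑edges G (λ u v → h u)   ≡⟨ cong (∑edges G (λ u v → h u) +_) (+-identityʳ _) ⟨
      2 * ∑edges G (λ u v → h u)                        ∎
      where open ≡-Reasoning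

∑F-monochromaticEdges² : (G : Graph n) (w : (Fin n → Fin k) → ℕ) →
  ∑F n (λ κ → w κ * (monochromaticEdges G κ * monochromaticEdges G κ))
    ≡ ∑edges G (λ p q → ∑edges G (λ r s → ∑F n (λ κ → w κ * (δ (κ p) (κ q) * δ (κ r) (κ s)))))
∑F-monochromaticEdges² {n} G w = begin
  ∑F n (λ κ → w κ * (monochromaticEdges G κ * monochromaticEdges G κ))
    ≡⟨ ∑F-cong n (λ κ → *-assoc (w κ) _ _) ⟨
  ∑F n (λ κ → w κ * monochromaticEdges G κ * monochromaticEdges G κ)
    ≡⟨ ∑F-monochromaticEdges G (λ κ → w κ * monochromaticEdges G κ) ⟩
  ∑edges G (λ p q → ∑F n (λ κ → w κ * monochromaticEdges G κ * δ (κ p) (κ q)))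
    ≡⟨ ∑edges-cong G (λ p q _ → ∑F-cong n (λ κ → swap₂₃ (w κ) (monochromaticEdges G κ) (δ (κ p) (κ q)))) ⟩
  ∑edges G (λ p q → ∑F n (λ κ → w κ * δ (κ p) (κ q) * monochromaticEdges G κ))
    ≡⟨ ∑edges-cong G (λ p q _ → ∑F-monochromaticEdges G (λ κ → w κ * δ (κ p) (κ q))) ⟩
  ∑edges G (λ p q → ∑edges G (λ r s → ∑F n (λ κ → w κ * δ (κ p) (κ q) * δ (κ r) (κ s))))
    ≡⟨ ∑edges-cong G (λ p q _ → ∑edges-cong G (λ r s _ → ∑F-cong n (λ κ → *-assoc (w κ) _ _))) ⟩
  ∑edges G (λ p q → ∑edges G (λ r s → ∑F n (λ κ → w κ * (δ (κ p) (κ q) * δ (κ r) (κ s))))) ∎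
  where
  open ≡-Reasoning
  swap₂₃ : ∀ a b c → a * b * c ≡ a * c * b
  swap₂₃ = solve-∀

colourings : ℕ → ℕ → ℕ
colourings n j = ∑F {n} n (λ κ → ⟦ coincidences κ ≡ᵇ j ⟧)

≡ᵇ-guard : ∀ x j {a b} → (x ≡ j → a ≡ b) → ⟦ x ≡ᵇ j ⟧ * a ≡ ⟦ x ≡ᵇ j ⟧ * b
≡ᵇ-guard x j a≡b with x ≡ᵇ j in x≡ᵇj
... | true = cong (_+ 0) (a≡b (≡ᵇ⇒≡ x j (subst T (sym x≡ᵇj) _)))
... | false = refl

∑F-proper-monochromatic : (G : Graph n) (j a b : ℕ) →
  a * properColourings G j + b * ∑F n (λ κ → ⟦ coincidences κ ≡ᵇ j ⟧ * monochromaticEdges G κ)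
    ≡ ∑F n (λ κ → ⟦ coincidences κ ≡ᵇ j ⟧ * (a * ⟦ isProper G κ ⟧ + b * monochromaticEdges G κ))
∑F-proper-monochromatic {n} G j a b = begin
  a * properColourings G j + b * ∑F n (λ κ → ⟦ coincidences κ ≡ᵇ j ⟧ * monochromaticEdges G κ)
    ≡⟨ cong₂ _+_ (*-distribˡ-∑F n a _) (*-distribˡ-∑F n b _) ⟩
  ∑F n (λ κ → a * (⟦ isProper G κ ⟧ * ⟦ coincidences κ ≡ᵇ j ⟧)) + ∑F n (λ κ → b * (⟦ coincidences κ ≡ᵇ j ⟧ * monochromaticEdges G κ))
    ≡⟨ ∑F-distrib-+ n _ _ ⟨
  ∑F n (λ κ → a * (⟦ isProper G κ ⟧ * ⟦ coincidences κ ≡ᵇ j ⟧) + b * (⟦ coincidences κ ≡ᵇ j ⟧ * monochromaticEdges G κ))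
    ≡⟨ ∑F-cong n (λ κ → factor a b ⟦ isProper G κ ⟧ ⟦ coincidences κ ≡ᵇ j ⟧ (monochromaticEdges G κ)) ⟩
  ∑F n (λ κ → ⟦ coincidences κ ≡ᵇ j ⟧ * (a * ⟦ isProper G κ ⟧ + b * monochromaticEdges G κ)) ∎
  where
  open ≡-Reasoning
  factor : ∀ a b p e m → a * (p * e) + b * (e * m) ≡ e * (a * p + b * m)
  factor = solve-∀

degreeSum-relation : ∀ r (G : Graph (2 + r)) →
  2 * properColourings G 2 + degreeSum G * joining {2 + r} 2 0F 1F ≡ 2 * colourings (2 + r) 2
degreeSum-relation r G = begin
  2 * properColourings G 2 + degreeSum G * c
    ≡⟨ cong (2 * properColourings G 2 +_) (trans (sym (∑edges-const G c)) (∑edges-cong G on-edges)) ⟩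
  2 * properColourings G 2 + ∑edges G (joining 2)
    ≡⟨ cong (2 * properColourings G 2 +_) (trans (*-identityˡ _) (∑F-monochromaticEdges G (λ κ → ⟦ coincidences κ ≡ᵇ 2 ⟧))) ⟨
  2 * properColourings G 2 + 1 * ∑F {2 + r} (2 + r) (λ κ → ⟦ coincidences κ ≡ᵇ 2 ⟧ * monochromaticEdges G κ)
    ≡⟨ ∑F-proper-monochromatic G 2 2 1 ⟩
  ∑F {2 + r} (2 + r) (λ κ → ⟦ coincidences κ ≡ᵇ 2 ⟧ * (2 * ⟦ isProper G κ ⟧ + 1 * monochromaticEdges G κ))
    ≡⟨ ∑F-cong {2 + r} (2 + r) (λ κ → ≡ᵇ-guard (coincidences κ) 2 (λ two →
         trans (cong (2 * ⟦ isProper G κ ⟧ +_) (*-identityˡ _)) (proper-with-two-coincidences G κ two))) ⟩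
  ∑F {2 + r} (2 + r) (λ κ → ⟦ coincidences κ ≡ᵇ 2 ⟧ * 2)
    ≡⟨ trans (*-distribˡ-∑F {2 + r} (2 + r) 2 (λ κ → ⟦ coincidences κ ≡ᵇ 2 ⟧)) (∑F-cong {2 + r} (2 + r) (λ κ → *-comm 2 ⟦ coincidences κ ≡ᵇ 2 ⟧)) ⟨
  2 * colourings (2 + r) 2 ∎
  where
  open ≡-Reasoning
  c : ℕ
  c = joining {2 + r} 2 0F 1F
  on-edges : ∀ u v → adj G u v ≡ true → c ≡ joining 2 u v
  on-edges u v uv = joining-constant {2 + r} 2 {0F} {1F} (λ ()) (adj-irreflexive G uv)

degreeSum-determined : ∀ r (G H : Graph (2 + r)) → SameCSF G H → degreeSum G ≡ degreeSum H
degreeSum-determined r G H same = *-cancelʳ-≡ _ _ _ {{>-nonZero (joining-positive r)}}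
  (+-cancelˡ-≡ (2 * properColourings G 2) _ _ (begin
    2 * properColourings G 2 + degreeSum G * joining {2 + r} 2 0F 1F ≡⟨ degreeSum-relation r G ⟩
    2 * colourings (2 + r) 2                                ≡⟨ degreeSum-relation r H ⟨
    2 * properColourings H 2 + degreeSum H * joining {2 + r} 2 0F 1F ≡⟨ cong (λ p → 2 * p + degreeSum H * joining {2 + r} 2 0F 1F) (properColourings-determined G H same 2) ⟨
    2 * properColourings G 2 + degreeSum H * joining {2 + r} 2 0F 1F ∎))
  where open ≡-Reasoning

-- Squared degrees

private
  two-ways : ∀ a b → a + b * 2 ≡ b + (a + b) * 1
  two-ways = solve-∀
  one-way : ∀ a b → 0 + b * 1 ≡ b + (a + b) * 0
  one-way = solve-∀
  no-way : ∀ a b → b + b * 0 ≡ b + (a + b) * 0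
  no-way = solve-∀

-- Inclusion–exclusion over how two pairs of distinct vertices meet: they are equal, reversed,
-- share exactly one vertex, or are disjoint.
pair-of-pairs : (x a b : ℕ) {p q r s : Fin n} → p ≢ q → r ≢ s →
  (p ≡ r → q ≡ s → x ≡ a) → (p ≡ s → q ≡ r → x ≡ a) →
  (p ≡ r → p ≢ s → q ≢ s → x ≡ 0) → (p ≡ s → p ≢ r → q ≢ r → x ≡ 0) →
  (q ≡ r → p ≢ s → q ≢ s → x ≡ 0) → (q ≡ s → p ≢ r → q ≢ r → x ≡ 0) →
  (p ≢ r → p ≢ s → q ≢ r → q ≢ s → x ≡ b) →
  x + b * ((δ p r + δ q r) + (δ p s + δ q s)) ≡ b + (a + b) * (δ p r * δ q s + δ p s * δ q r)
pair-of-pairs x a b {p} {q} {r} {s} p≢q r≢s equal reversed meet-pr meet-ps meet-qr meet-qs disjoint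
  with p ≟ r | p ≟ s | q ≟ r | q ≟ s
... | yes p≡r | yes p≡s | _ | _ = ⊥-elim (r≢s (trans (sym p≡r) p≡s))
... | yes p≡r | no _ | yes q≡r | _ = ⊥-elim (p≢q (trans p≡r (sym q≡r)))
... | yes p≡r | no _ | no _ | yes q≡s = trans (cong (_+ b * 2) (equal p≡r q≡s)) (two-ways a b)
... | yes p≡r | no p≢s | no _ | no q≢s = trans (cong (_+ b * 1) (meet-pr p≡r p≢s q≢s)) (one-way a b)
... | no _ | yes p≡s | yes _ | yes q≡s = ⊥-elim (p≢q (trans p≡s (sym q≡s)))
... | no _ | yes p≡s | yes q≡r | no _ = trans (cong (_+ b * 2) (reversed p≡s q≡r)) (two-ways a b)
... | no _ | yes p≡s | no _ | yes q≡s = ⊥-elim (p≢q (trans p≡s (sym q≡s)))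
... | no p≢r | yes p≡s | no q≢r | no _ = trans (cong (_+ b * 1) (meet-ps p≡s p≢r q≢r)) (one-way a b)
... | no _ | no _ | yes q≡r | yes q≡s = ⊥-elim (r≢s (trans (sym q≡r) q≡s))
... | no _ | no p≢s | yes q≡r | no q≢s = trans (cong (_+ b * 1) (meet-qr q≡r p≢s q≢s)) (one-way a b)
... | no p≢r | no _ | no q≢r | yes q≡s = trans (cong (_+ b * 1) (meet-qs q≡s p≢r q≢r)) (one-way a b)
... | no p≢r | no p≢s | no q≢r | no q≢s = trans (cong (_+ b * 0) (disjoint p≢r p≢s q≢r q≢s)) (no-way a b)

module _ {t : ℕ} (G : Graph (4 + t)) where

  private
    c₂ c₄ : ℕ
    c₂ = joining {4 + t} 4 0F 1F
    c₄ = joining₂ {4 + t} 4 0F 1F 2F 3F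

  joining₂-on-edges : {p q r s : Fin (4 + t)} → adj G p q ≡ true → adj G r s ≡ true →
    joining₂ 4 p q r s + c₄ * ((δ p r + δ q r) + (δ p s + δ q s)) ≡ c₄ + (c₂ + c₄) * (δ p r * δ q s + δ p s * δ q r)
  joining₂-on-edges {p} {q} {r} {s} pq rs = pair-of-pairs (joining₂ 4 p q r s) c₂ c₄ p≢q r≢s
    (λ { refl refl → trans (joining₂-same 4 p q) c₂-on-edge })
    (λ { refl refl → trans (joining₂-reversed 4 p q) c₂-on-edge })
    (λ { refl p≢s q≢s → joining₂-vanishes (λ κ e₁ e₂ → coincidences-≥6 κ p≢q p≢s q≢s e₁ e₂) })
    (λ { refl p≢r q≢r → joining₂-vanishes (λ κ e₁ e₂ → coincidences-≥6 κ p≢q p≢r q≢r e₁ (sym e₂)) })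
    (λ { refl p≢s q≢s → joining₂-vanishes (λ κ e₁ e₂ → coincidences-≥6 κ p≢q p≢s q≢s e₁ (trans e₁ e₂)) })
    (λ { refl p≢r q≢r → joining₂-vanishes (λ κ e₁ e₂ → coincidences-≥6 κ p≢q p≢r q≢r e₁ (trans e₁ (sym e₂))) })
    (λ p≢r p≢s q≢r q≢s → joining₂-constant {4 + t} 4 {p} {q} {r} {s} {0F} {1F} {2F} {3F}
                            p≢q p≢r p≢s q≢r q≢s r≢s (λ ()) (λ ()) (λ ()) (λ ()) (λ ()) (λ ()))
    where
    p≢q : p ≢ q
    p≢q = adj-irreflexive G pq
    r≢s : r ≢ s
    r≢s = adj-irreflexive G rs
    c₂-on-edge : joining 4 p q ≡ c₂
    c₂-on-edge = joining-constant {4 + t} 4 {p} {q} {0F} {1F} p≢q (λ ())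

  monochromaticEdges²-relation : 8 * properColourings G 4 + 6 * (degreeSum G * c₂)
    ≡ 8 * colourings (4 + t) 4 + ∑edges G (λ p q → ∑edges G (joining₂ 4 p q))
  monochromaticEdges²-relation = begin
    8 * properColourings G 4 + 6 * (degreeSum G * c₂)
      ≡⟨ cong (λ x → 8 * properColourings G 4 + 6 * x)
              (trans (sym (∑edges-const G c₂)) (∑edges-cong G (λ u v uv → joining-constant {4 + t} 4 {0F} {1F} {u} {v} (λ ()) (adj-irreflexive G uv)))) ⟩
    8 * properColourings G 4 + 6 * ∑edges G (joining 4)
      ≡⟨ cong (λ x → 8 * properColourings G 4 + 6 * x) (∑F-monochromaticEdges G (λ κ → ⟦ coincidences κ ≡ᵇ 4 ⟧)) ⟨
    8 * properColourings G 4 + 6 * ∑F {4 + t} (4 + t) (λ κ → ⟦ coincidences κ ≡ᵇ 4 ⟧ * monochromaticEdges G κ)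
      ≡⟨ ∑F-proper-monochromatic G 4 8 6 ⟩
    ∑F {4 + t} (4 + t) (λ κ → ⟦ coincidences κ ≡ᵇ 4 ⟧ * (8 * ⟦ isProper G κ ⟧ + 6 * monochromaticEdges G κ))
      ≡⟨ ∑F-cong {4 + t} (4 + t) (λ κ → ≡ᵇ-guard (coincidences κ) 4 (proper-with-four-coincidences G κ)) ⟩
    ∑F {4 + t} (4 + t) (λ κ → ⟦ coincidences κ ≡ᵇ 4 ⟧ * (8 + monochromaticEdges G κ * monochromaticEdges G κ))
      ≡⟨ trans (∑F-cong {4 + t} (4 + t) (λ κ → *-distribˡ-+ ⟦ coincidences κ ≡ᵇ 4 ⟧ 8 (monochromaticEdges G κ * monochromaticEdges G κ)))
               (∑F-distrib-+ {4 + t} (4 + t) (λ κ → ⟦ coincidences κ ≡ᵇ 4 ⟧ * 8) (λ κ → ⟦ coincidences κ ≡ᵇ 4 ⟧ * (monochromaticEdges G κ * monochromaticEdges G κ))) ⟩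
    ∑F {4 + t} (4 + t) (λ κ → ⟦ coincidences κ ≡ᵇ 4 ⟧ * 8)
      + ∑F {4 + t} (4 + t) (λ κ → ⟦ coincidences κ ≡ᵇ 4 ⟧ * (monochromaticEdges G κ * monochromaticEdges G κ))
      ≡⟨ cong (_+ ∑F {4 + t} (4 + t) (λ κ → ⟦ coincidences κ ≡ᵇ 4 ⟧ * (monochromaticEdges G κ * monochromaticEdges G κ)))
               (trans (*-distribˡ-∑F {4 + t} (4 + t) 8 (λ κ → ⟦ coincidences κ ≡ᵇ 4 ⟧)) (∑F-cong {4 + t} (4 + t) (λ κ → *-comm 8 ⟦ coincidences κ ≡ᵇ 4 ⟧))) ⟨
    8 * colourings (4 + t) 4
      + ∑F {4 + t} (4 + t) (λ κ → ⟦ coincidences κ ≡ᵇ 4 ⟧ * (monochromaticEdges G κ * monochromaticEdges G κ))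
      ≡⟨ cong (8 * colourings (4 + t) 4 +_) (∑F-monochromaticEdges² G (λ κ → ⟦ coincidences κ ≡ᵇ 4 ⟧)) ⟩
    8 * colourings (4 + t) 4 + ∑edges G (λ p q → ∑edges G (joining₂ 4 p q)) ∎
    where open ≡-Reasoning

  ∑edges²-joining₂ : ∑edges G (λ p q → ∑edges G (joining₂ 4 p q)) + c₄ * (2 * (2 * squareDegreeSum G))
    ≡ degreeSum G * (degreeSum G * c₄) + (c₂ + c₄) * (degreeSum G + degreeSum G)
  ∑edges²-joining₂ = begin
    ∑edges G (λ p q → ∑edges G (joining₂ 4 p q)) + c₄ * (2 * (2 * squareDegreeSum G))
      ≡⟨ cong (λ x → ∑edges G (λ p q → ∑edges G (joining₂ 4 p q)) + c₄ * (2 * x)) (trans (∑edges-symmetrize G (degree G)) (cong (2 *_) (∑edges-degree G))) ⟨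
    ∑edges G (λ p q → ∑edges G (joining₂ 4 p q)) + c₄ * (2 * ∑edges G (λ p q → degree G p + degree G q))
      ≡⟨ cong (λ x → ∑edges G (λ p q → ∑edges G (joining₂ 4 p q)) + c₄ * x) (*-distribˡ-∑edges G 2 (λ p q → degree G p + degree G q)) ⟩
    ∑edges G (λ p q → ∑edges G (joining₂ 4 p q)) + c₄ * ∑edges G (λ p q → 2 * (degree G p + degree G q))
      ≡⟨ trans (∑edges-cong G (λ p q _ → inner-ends p q))
               (∑edges-+* G (λ p q → ∑edges G (joining₂ 4 p q)) (λ p q → 2 * (degree G p + degree G q)) c₄) ⟨
    ∑edges G (λ p q → ∑edges G (λ r s → joining₂ 4 p q r s + c₄ * ((δ p r + δ q r) + (δ p s + δ q s))))
      ≡⟨ ∑edges-cong G (λ p q pq → ∑edges-cong G (λ r s rs → joining₂-on-edges pq rs)) ⟩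
    ∑edges G (λ p q → ∑edges G (λ r s → c₄ + (c₂ + c₄) * (δ p r * δ q s + δ p s * δ q r)))
      ≡⟨ trans (∑edges-cong G (λ p q _ → inner-matchings p q))
               (∑edges-+* G (λ _ _ → degreeSum G * c₄) (λ p q → ⟦ adj G p q ⟧ + ⟦ adj G p q ⟧) (c₂ + c₄)) ⟩
    ∑edges G (λ _ _ → degreeSum G * c₄) + (c₂ + c₄) * ∑edges G (λ p q → ⟦ adj G p q ⟧ + ⟦ adj G p q ⟧)
      ≡⟨ cong₂ (λ x y → x + (c₂ + c₄) * y) (∑edges-const G (degreeSum G * c₄))
               (trans (∑edges-distrib-+ G (λ p q → ⟦ adj G p q ⟧) (λ p q → ⟦ adj G p q ⟧)) (cong₂ _+_ (∑edges-degreeSum G) (∑edges-degreeSum G))) ⟩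
    degreeSum G * (degreeSum G * c₄) + (c₂ + c₄) * (degreeSum G + degreeSum G) ∎
    where
    open ≡-Reasoning
    inner-ends : ∀ p q → ∑edges G (λ r s → joining₂ 4 p q r s + c₄ * ((δ p r + δ q r) + (δ p s + δ q s)))
                           ≡ ∑edges G (joining₂ 4 p q) + c₄ * (2 * (degree G p + degree G q))
    inner-ends p q = trans (∑edges-+* G (joining₂ 4 p q) (λ r s → (δ p r + δ q r) + (δ p s + δ q s)) c₄)
                           (cong (λ x → ∑edges G (joining₂ 4 p q) + c₄ * x) (begin
      ∑edges G (λ r s → (δ p r + δ q r) + (δ p s + δ q s))     ≡⟨ ∑edges-symmetrize G (λ z → δ p z + δ q z) ⟩
      2 * ∑edges G (λ r s → δ p r + δ q r)                     ≡⟨ cong (2 *_) (∑edges-distrib-+ G (λ r s → δ p r) (λ r s → δ q r)) ⟩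
      2 * (∑edges G (λ r s → δ p r) + ∑edges G (λ r s → δ q r)) ≡⟨ cong (2 *_) (cong₂ _+_ (∑edges-δ G p) (∑edges-δ G q)) ⟩
      2 * (degree G p + degree G q)                            ∎))
    inner-matchings : ∀ p q → ∑edges G (λ r s → c₄ + (c₂ + c₄) * (δ p r * δ q s + δ p s * δ q r))
                                ≡ degreeSum G * c₄ + (c₂ + c₄) * (⟦ adj G p q ⟧ + ⟦ adj G p q ⟧)
    inner-matchings p q = trans (∑edges-+* G (λ _ _ → c₄) (λ r s → δ p r * δ q s + δ p s * δ q r) (c₂ + c₄))
                                (cong₂ (λ x y → x + (c₂ + c₄) * y) (∑edges-const G c₄) (begin
      ∑edges G (λ r s → δ p r * δ q s + δ p s * δ q r)                   ≡⟨ ∑edges-distrib-+ G (λ r s → δ p r * δ q s) (λ r s → δ p s * δ q r) ⟩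
      ∑edges G (λ r s → δ p r * δ q s) + ∑edges G (λ r s → δ p s * δ q r) ≡⟨ cong (∑edges G (λ r s → δ p r * δ q s) +_) (∑edges-swap G (λ r s → δ p s * δ q r)) ⟩
      ∑edges G (λ r s → δ p r * δ q s) + ∑edges G (λ r s → δ p r * δ q s) ≡⟨ cong₂ _+_ (∑edges-δδ G p q) (∑edges-δδ G p q) ⟩
      ⟦ adj G p q ⟧ + ⟦ adj G p q ⟧                                        ∎))

  squareDegreeSum-relation :
    8 * properColourings G 4 + 6 * (degreeSum G * joining 4 0F 1F) + joining₂ 4 0F 1F 2F 3F * (2 * (2 * squareDegreeSum G))
      ≡ 8 * colourings (4 + t) 4
        + (degreeSum G * (degreeSum G * joining₂ 4 0F 1F 2F 3F) + (joining 4 0F 1F + joining₂ 4 0F 1F 2F 3F) * (degreeSum G + degreeSum G))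
  squareDegreeSum-relation =
    trans (cong (_+ c₄ * (2 * (2 * squareDegreeSum G))) monochromaticEdges²-relation)
          (trans (+-assoc (8 * colourings (4 + t) 4) _ _) (cong (8 * colourings (4 + t) 4 +_) ∑edges²-joining₂))

squareDegreeSum-determined-4+ : ∀ t (G H : Graph (4 + t)) → SameCSF G H → squareDegreeSum G ≡ squareDegreeSum H
squareDegreeSum-determined-4+ t G H same =
  *-cancelˡ-≡ _ _ 2 (*-cancelˡ-≡ _ _ 2 (*-cancelˡ-≡ _ _ c₄ {{>-nonZero (joining₂-positive t)}}
    (+-cancelˡ-≡ (8 * properColourings G 4 + 6 * (degreeSum G * c₂)) _ _ (begin
      8 * properColourings G 4 + 6 * (degreeSum G * c₂) + c₄ * (2 * (2 * squareDegreeSum G))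
        ≡⟨ squareDegreeSum-relation G ⟩
      8 * colourings (4 + t) 4 + (degreeSum G * (degreeSum G * c₄) + (c₂ + c₄) * (degreeSum G + degreeSum G))
        ≡⟨ cong (λ d → 8 * colourings (4 + t) 4 + (d * (d * c₄) + (c₂ + c₄) * (d + d))) degreeSum≡ ⟩
      8 * colourings (4 + t) 4 + (degreeSum H * (degreeSum H * c₄) + (c₂ + c₄) * (degreeSum H + degreeSum H))
        ≡⟨ squareDegreeSum-relation H ⟨
      8 * properColourings H 4 + 6 * (degreeSum H * c₂) + c₄ * (2 * (2 * squareDegreeSum H))
        ≡⟨ cong₂ (λ p d → 8 * p + 6 * (d * c₂) + c₄ * (2 * (2 * squareDegreeSum H))) (properColourings-determined G H same 4) degreeSum≡ ⟨
      8 * properColourings G 4 + 6 * (degreeSum G * c₂) + c₄ * (2 * (2 * squareDegreeSum H)) ∎))))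
  where
  open ≡-Reasoning
  c₂ c₄ : ℕ
  c₂ = joining {4 + t} 4 0F 1F
  c₄ = joining₂ {4 + t} 4 0F 1F 2F 3F
  degreeSum≡ : degreeSum G ≡ degreeSum H
  degreeSum≡ = degreeSum-determined (2 + t) G H same

-- Small graphs, and the theorem

squareDegreeSum₁ : (G : Graph 1) → squareDegreeSum G ≡ 0
squareDegreeSum₁ G = trans (squareDegreeSum-∑ G) by-cases
  where
  by-cases : ∑[ u < 1 ] degree² G u ≡ 0
  by-cases rewrite irrefl G 0F = refl

squareDegreeSum₂ : (G : Graph 2) → squareDegreeSum G ≡ degreeSum G
squareDegreeSum₂ G = trans (squareDegreeSum-∑ G) (trans by-cases (sym (degreeSum-∑ G)))
  where
  by-cases : ∑[ u < 2 ] degree² G u ≡ ∑[ u < 2 ] ∑[ v < 2 ] ⟦ adj G u v ⟧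
  by-cases rewrite irrefl G 0F | irrefl G 1F | adj-sym G 1F 0F with adj G 0F 1F
  ... | true = refl
  ... | false = refl

squareDegreeSum₃ : (G : Graph 3) → 4 * squareDegreeSum G ≡ degreeSum G * degreeSum G + 2 * degreeSum G
squareDegreeSum₃ G rewrite squareDegreeSum-∑ G | degreeSum-∑ G = by-cases
  where
  by-cases : 4 * ∑[ u < 3 ] degree² G u
             ≡ ∑[ u < 3 ] ∑[ v < 3 ] ⟦ adj G u v ⟧ * ∑[ u < 3 ] ∑[ v < 3 ] ⟦ adj G u v ⟧ + 2 * ∑[ u < 3 ] ∑[ v < 3 ] ⟦ adj G u v ⟧
  by-cases rewrite irrefl G 0F | irrefl G 1F | irrefl G 2F | adj-sym G 1F 0F | adj-sym G 2F 0F | adj-sym G 2F 1F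
    with adj G 0F 1F | adj G 0F 2F | adj G 1F 2F
  ... | true | true | true = refl
  ... | true | true | false = refl
  ... | true | false | true = refl
  ... | true | false | false = refl
  ... | false | true | true = refl
  ... | false | true | false = refl
  ... | false | false | true = refl
  ... | false | false | false = refl

squareDegreeSum-determined : (G H : Graph n) → SameCSF G H → squareDegreeSum G ≡ squareDegreeSum H
squareDegreeSum-determined {0} G H same = trans (squareDegreeSum-∑ G) (sym (squareDegreeSum-∑ H))
squareDegreeSum-determined {1} G H same = trans (squareDegreeSum₁ G) (sym (squareDegreeSum₁ H))
squareDegreeSum-determined {2} G H same =
  trans (squareDegreeSum₂ G) (trans (degreeSum-determined 0 G H same) (sym (squareDegreeSum₂ H)))
squareDegreeSum-determined {3} G H same = *-cancelˡ-≡ _ _ 4 (begin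
  4 * squareDegreeSum G                         ≡⟨ squareDegreeSum₃ G ⟩
  degreeSum G * degreeSum G + 2 * degreeSum G   ≡⟨ cong (λ d → d * d + 2 * d) (degreeSum-determined 1 G H same) ⟩
  degreeSum H * degreeSum H + 2 * degreeSum H   ≡⟨ squareDegreeSum₃ H ⟨
  4 * squareDegreeSum H                         ∎)
  where open ≡-Reasoning
squareDegreeSum-determined {suc (suc (suc (suc t)))} G H same = squareDegreeSum-determined-4+ t G H same

proposition2p2 : ∀ {n m : ℕ} (G : Graph n) (H : Graph m) →
    SameCSF G H → sumSqDeg G ≡ sumSqDeg H
proposition2p2 G H same with vertexCount-determined G H same
... | refl = begin
  sumSqDeg G        ≡⟨ sumSqDeg-squareDegreeSum G ⟩
  squareDegreeSum G ≡⟨ squareDegreeSum-determined G H same ⟩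
  squareDegreeSum H ≡⟨ sumSqDeg-squareDegreeSum H ⟨
  sumSqDeg H        ∎
  where open ≡-Reasoning
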